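{- Let $m\ge 1$, let $n_1,\ldots,n_m$ be positive integers and set $n_{m+1}=n_1$. For every integer $j$ with $0\leq j\leq m-1$, the expression $$S(n_1,\ldots,n_m;j,q):={n_1+n_m\brack n_1}^{ -1}\sum_{k=-n_1}^{n_1}(-1)^k q^{jk^2+\binom{k}{2}}\prod_{i=1}^m {n_i+n_{i+1}\brack n_i+k}$$ is a polynomial in $q$ with nonnegative integer coefficients.
   Context: For an integer $n\ge 0$, $(q)_n=(1-q)(1-q^2)\cdots(1-q^n)$ (with $(q)_0=1$), and $1/(q)_n=0$ for $n<0$. The $q$-binomial coefficient is ${n\brack k}=\frac{(q)_n}{(q)_k(q)_{n-k}}$, so that ${n\brack k}=0$ if $k>n$ or $k<0$. -}

module Defs where

open import Data.Nat using (ℕ; zero; suc; _+_; _*_; _∸_; _≤_; _<_)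
open import Data.Nat.Combinatorics using (_C_)
open import Data.Integer as ℤ using (ℤ; +_; -[1+_])
open import Data.List using (List; []; _∷_; _++_; map; replicate; zipWith; foldr; upTo; length)
open import Relation.Binary.PropositionalEquality using (_≡_)

-- Polynomials in q with integer coefficients, as coefficient lists
-- (constant term first).  Equality is coefficientwise (trailing zeros ignored).
Poly : Set
Poly = List ℤ

coeff : Poly → ℕ → ℤ
coeff []       _       = + 0
coeff (a ∷ p)  zero    = a
coeff (a ∷ p)  (suc d) = coeff p d

infix 4 _≈ₚ_
_≈ₚ_ : Poly → Poly → Set
p ≈ₚ r = ∀ d → coeff p d ≡ coeff r d

infixl 6 _+ₚ_
_+ₚ_ : Poly → Poly → Poly
[]      +ₚ r       = r
(a ∷ p) +ₚ []      = a ∷ p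
(a ∷ p) +ₚ (b ∷ r) = (a ℤ.+ b) ∷ (p +ₚ r)

scaleₚ : ℤ → Poly → Poly
scaleₚ c = map (c ℤ.*_)

infixl 7 _*ₚ_
_*ₚ_ : Poly → Poly → Poly
[]      *ₚ r = []
(a ∷ p) *ₚ r = scaleₚ a r +ₚ (+ 0 ∷ (p *ₚ r))

qpow : ℕ → Poly
qpow e = replicate e (+ 0) ++ (+ 1 ∷ [])

oneₚ : Poly
oneₚ = + 1 ∷ []

sumₚ : List Poly → Poly
sumₚ = foldr _+ₚ_ []

prodₚ : List Poly → Poly
prodₚ = foldr _*ₚ_ oneₚ

-- Gaussian (q-)binomial coefficient [n, k] as a polynomial in q, for k ∈ ℕ,
-- via the q-Pascal rule [n+1,k+1] = [n,k] + q^(k+1) [n,k+1]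
-- (this is (q)_n / ((q)_k (q)_(n-k)) for k ≤ n, and 0 for k > n).
qbin : ℕ → ℕ → Poly
qbin n       zero    = oneₚ
qbin zero    (suc k) = []
qbin (suc n) (suc k) = qbin n k +ₚ qpow (suc k) *ₚ qbin n (suc k)

qbinℤ : ℕ → ℤ → Poly
qbinℤ n (+ k)     = qbin n k
qbinℤ n -[1+ k ]  = []

choose2 : ℤ → ℕ
choose2 (+ k)    = k C 2
choose2 -[1+ k ] = (suc (suc k)) C 2   -- k' = -(k+1): k'(k'-1)/2 = (k+1)(k+2)/2

sign : ℤ → ℤ
sign k = (ℤ.- (+ 1)) ℤ.^ ℤ.∣ k ∣

lastOf : ℕ → List ℕ → ℕ
lastOf a []       = a
lastOf a (b ∷ bs) = lastOf b bs

-- The sequence n₁,…,n_m is given as (n₁ ∷ rest), m = 1 + length rest.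
-- Cyclic consecutive pairs (n_i, n_{i+1}), i = 1..m, with n_{m+1} = n₁.
cycPairsSum : ℕ → List ℕ → List ℕ
cycPairsSum n₁ rest = zipWith _+_ (n₁ ∷ rest) (rest ++ (n₁ ∷ []))

summand : ℕ → List ℕ → ℕ → ℤ → Poly
summand n₁ rest j k =
  scaleₚ (sign k)
    (qpow (j * ℤ.∣ k ∣ * ℤ.∣ k ∣ + choose2 k)
      *ₚ prodₚ (zipWith (λ a s → qbinℤ s ((+ a) ℤ.+ k))
                        (n₁ ∷ rest) (cycPairsSum n₁ rest)))

Ssum : ℕ → List ℕ → ℕ → Poly
Ssum n₁ rest j =
  sumₚ (map (λ t → summand n₁ rest j ((+ t) ℤ.- (+ n₁))) (upTo (suc (2 * n₁))))

{-# OPTIONS --safe #-}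
-- Write E(a, b; k) = [a + b, a + k] for the factor contributed by the edge a → b of the
-- cycle n₁ → ⋯ → n_m → n₁. Vandermonde's identity for the middle factor, followed by two
-- trinomial revisions, gives for every integer k
--   q^(εk²) E(a,b;k) E(b,c;k) E(c,d;k) = Σ_{r ≤ min(b,c)} w_ε(a,b,c,d,r) E(a,r;k) E(r,d;k)
-- with w_ε a product of a power of q and two q-binomials (ε ∈ {0, 1}), and likewise
--   q^(εk²) E(n,b;k) E(b,n;k) = Σ_{r ≤ min(b,n)} w′_ε(n,b,r) E(r,r;k).
-- Taking ε = 1 when j ≥ 1 turns the sum for a cycle of length m ≥ 3 and parameter j into a
-- combination with nonnegative coefficients of sums for length m − 1 and parameter j − 1
-- (or j, when j = 0). For m = 2 one is left with Σ_k (−1)^k q^C(k,2) [2r, r + k], which by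
-- the q-binomial theorem vanishes unless r = 0. So S is [n₁ + n_m, n₁] times a polynomial
-- with nonnegative coefficients; the last vertex changes only in the step from m = 3 to
-- m = 2, which one more trinomial revision absorbs. Positivity of the n_i is needed only
-- for m = 1, where the sum vanishes.
module Submission where

open import Defs
open import Data.Nat using (ℕ; _≤_; _<_; _+_)
open import Data.List using (List; _∷_; length; map)
open import Data.List.Relation.Unary.All using (All)
open import Data.Integer using (+_)
open import Data.Product using (∃)

open import Data.Nat as ℕ using (zero; suc; z≤n; s≤s; _∸_; _⊓_)
import Data.Nat.Properties as ℕP
open import Data.Nat.Combinatorics using (_C_; nCk+nC[k+1]≡[n+1]C[k+1]; nC1≡n)
open import Data.Integer as ℤ using (ℤ; -[1+_]; 0ℤ)
import Data.Integer.Properties as ℤP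
open import Data.List using ([]; _++_; zipWith; applyUpTo)
open import Data.List.Relation.Unary.All using (_∷_)
open import Data.Product using (_,_; _×_)
open import Function using (_∘_; id)
open import Data.Maybe using (Maybe; just; nothing)
open import Data.Bool using (Bool; true; false)
open import Data.Sum using (inj₁; inj₂)
open import Relation.Nullary using (yes; no)
open import Relation.Binary.PropositionalEquality using (_≡_; refl; sym; trans; cong; cong₂; subst)
open import Relation.Binary.Bundles using (Setoid)
open import Relation.Binary.Structures using (IsEquivalence)
open import Algebra.Bundles using (CommutativeRing)
open import Tactic.RingSolver using (solve-∀)
open import Tactic.RingSolver.Core.AlmostCommutativeRing using (AlmostCommutativeRing; fromCommutativeRing)
import Data.Nat.Tactic.RingSolver as ℕ-Solver
import Data.Integer.Tactic.RingSolver as ℤ-Solver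
import Relation.Binary.Reasoning.Setoid as SetoidReasoning
import Algebra.Properties.CommutativeSemigroup ℤP.+-commutativeSemigroup as ℤ+

coeff-+ₚ : ∀ p r d → coeff (p +ₚ r) d ≡ coeff p d ℤ.+ coeff r d
coeff-+ₚ []      r       d       = sym (ℤP.+-identityˡ _)
coeff-+ₚ (a ∷ p) []      d       = sym (ℤP.+-identityʳ _)
coeff-+ₚ (a ∷ p) (b ∷ r) zero    = refl
coeff-+ₚ (a ∷ p) (b ∷ r) (suc d) = coeff-+ₚ p r d

coeff-scaleₚ : ∀ c p d → coeff (scaleₚ c p) d ≡ c ℤ.* coeff p d
coeff-scaleₚ c []      d       = sym (ℤP.*-zeroʳ c)
coeff-scaleₚ c (a ∷ p) zero    = refl
coeff-scaleₚ c (a ∷ p) (suc d) = coeff-scaleₚ c p d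

-- A record rather than p ≈ₚ r itself: the latter is a Π-type from which
-- Agda cannot recover p and r, so implicit arguments would not be inferred.
infix 4 _≋_
record _≋_ (p r : Poly) : Set where
  constructor mk≋
  field coeff-≡ : p ≈ₚ r
open _≋_

≋-refl : ∀ {p} → p ≋ p
≋-refl = mk≋ λ _ → refl

≋-sym : ∀ {p r} → p ≋ r → r ≋ p
≋-sym (mk≋ e) = mk≋ λ d → sym (e d)

≋-trans : ∀ {p r s} → p ≋ r → r ≋ s → p ≋ s
≋-trans (mk≋ e) (mk≋ f) = mk≋ λ d → trans (e d) (f d)

≡⇒≋ : ∀ {p r} → p ≡ r → p ≋ r
≡⇒≋ refl = ≋-refl

≋-isEquivalence : IsEquivalence _≋_
≋-isEquivalence = record { refl = ≋-refl ; sym = ≋-sym ; trans = ≋-trans }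

≋-setoid : Setoid _ _
≋-setoid = record { isEquivalence = ≋-isEquivalence }

open SetoidReasoning ≋-setoid

∷-cong : ∀ {a b p r} → a ≡ b → p ≋ r → (a ∷ p) ≋ (b ∷ r)
∷-cong refl (mk≋ e) = mk≋ λ { zero → refl ; (suc d) → e d }

[]≋0∷ : ∀ {p} → [] ≋ p → [] ≋ (+ 0 ∷ p)
[]≋0∷ (mk≋ e) = mk≋ λ { zero → refl ; (suc d) → e d }

+ₚ-cong : ∀ {p p′ r r′} → p ≋ p′ → r ≋ r′ → p +ₚ r ≋ p′ +ₚ r′
+ₚ-cong {p} {p′} {r} {r′} (mk≋ e) (mk≋ f) = mk≋ λ d →
  trans (coeff-+ₚ p r d) (trans (cong₂ ℤ._+_ (e d) (f d)) (sym (coeff-+ₚ p′ r′ d)))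

+ₚ-comm : ∀ p r → p +ₚ r ≋ r +ₚ p
+ₚ-comm p r = mk≋ λ d →
  trans (coeff-+ₚ p r d) (trans (ℤP.+-comm (coeff p d) (coeff r d)) (sym (coeff-+ₚ r p d)))

+ₚ-assoc : ∀ p r s → (p +ₚ r) +ₚ s ≋ p +ₚ (r +ₚ s)
+ₚ-assoc p r s = mk≋ λ d → trans (coeff-+ₚ (p +ₚ r) s d)
  (trans (cong (ℤ._+ coeff s d) (coeff-+ₚ p r d))
  (trans (ℤP.+-assoc (coeff p d) (coeff r d) (coeff s d))
  (trans (cong (λ x → coeff p d ℤ.+ x) (sym (coeff-+ₚ r s d))) (sym (coeff-+ₚ p (r +ₚ s) d)))))

+ₚ-identityʳ : ∀ p → p +ₚ [] ≋ p
+ₚ-identityʳ []      = ≋-refl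
+ₚ-identityʳ (a ∷ p) = ≋-refl

negₚ : Poly → Poly
negₚ = scaleₚ (ℤ.- + 1)

+ₚ-inverseˡ : ∀ p → negₚ p +ₚ p ≋ []
+ₚ-inverseˡ p = mk≋ λ d → trans (coeff-+ₚ (negₚ p) p d)
  (trans (cong (ℤ._+ coeff p d) (trans (coeff-scaleₚ (ℤ.- + 1) p d) (ℤP.-1*i≡-i (coeff p d))))
         (ℤP.+-inverseˡ (coeff p d)))

+ₚ-inverseʳ : ∀ p → p +ₚ negₚ p ≋ []
+ₚ-inverseʳ p = ≋-trans (+ₚ-comm p (negₚ p)) (+ₚ-inverseˡ p)

scaleₚ-cong : ∀ c {p r} → p ≋ r → scaleₚ c p ≋ scaleₚ c r
scaleₚ-cong c {p} {r} (mk≋ e) = mk≋ λ d →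
  trans (coeff-scaleₚ c p d) (trans (cong (c ℤ.*_) (e d)) (sym (coeff-scaleₚ c r d)))

scaleₚ-distrib-+ₚ : ∀ c p r → scaleₚ c (p +ₚ r) ≋ scaleₚ c p +ₚ scaleₚ c r
scaleₚ-distrib-+ₚ c p r = mk≋ λ d → trans (coeff-scaleₚ c (p +ₚ r) d)
  (trans (cong (c ℤ.*_) (coeff-+ₚ p r d))
  (trans (ℤP.*-distribˡ-+ c (coeff p d) (coeff r d))
  (sym (trans (coeff-+ₚ (scaleₚ c p) (scaleₚ c r) d)
              (cong₂ ℤ._+_ (coeff-scaleₚ c p d) (coeff-scaleₚ c r d))))))

scaleₚ-scaleₚ : ∀ a b p → scaleₚ a (scaleₚ b p) ≋ scaleₚ (a ℤ.* b) p
scaleₚ-scaleₚ a b p = mk≋ λ d → trans (coeff-scaleₚ a (scaleₚ b p) d)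
  (trans (cong (a ℤ.*_) (coeff-scaleₚ b p d))
  (trans (sym (ℤP.*-assoc a b (coeff p d))) (sym (coeff-scaleₚ (a ℤ.* b) p d))))

scaleₚ-one : ∀ p → scaleₚ (+ 1) p ≋ p
scaleₚ-one p = mk≋ λ d → trans (coeff-scaleₚ (+ 1) p d) (ℤP.*-identityˡ (coeff p d))

scaleₚ-zero : ∀ p → scaleₚ (+ 0) p ≋ []
scaleₚ-zero p = mk≋ (coeff-scaleₚ (+ 0) p)

convolution : (ℕ → ℤ) → (ℕ → ℤ) → ℕ → ℤ
convolution f g zero    = f 0 ℤ.* g 0
convolution f g (suc d) = f 0 ℤ.* g (suc d) ℤ.+ convolution (f ∘ suc) g d

convolution-cong : ∀ {f f′ g g′} → (∀ i → f i ≡ f′ i) → (∀ i → g i ≡ g′ i) →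
                   ∀ d → convolution f g d ≡ convolution f′ g′ d
convolution-cong ef eg zero    = cong₂ ℤ._*_ (ef 0) (eg 0)
convolution-cong ef eg (suc d) =
  cong₂ ℤ._+_ (cong₂ ℤ._*_ (ef 0) (eg (suc d))) (convolution-cong (ef ∘ suc) eg d)

convolution-zeroˡ : ∀ g d → convolution (λ _ → + 0) g d ≡ + 0
convolution-zeroˡ g zero    = refl
convolution-zeroˡ g (suc d) = trans (ℤP.+-identityˡ _) (convolution-zeroˡ g d)

coeff-*ₚ : ∀ p r d → coeff (p *ₚ r) d ≡ convolution (coeff p) (coeff r) d
coeff-*ₚ []      r d       = sym (trans
  (convolution-cong {g′ = coeff r} (λ { zero → refl ; (suc i) → refl }) (λ _ → refl) d)
  (convolution-zeroˡ (coeff r) d))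
coeff-*ₚ (a ∷ p) r zero    = trans (coeff-+ₚ (scaleₚ a r) _ 0)
  (trans (cong (ℤ._+ + 0) (coeff-scaleₚ a r 0)) (ℤP.+-identityʳ _))
coeff-*ₚ (a ∷ p) r (suc d) = trans (coeff-+ₚ (scaleₚ a r) _ (suc d))
  (cong₂ ℤ._+_ (coeff-scaleₚ a r (suc d)) (coeff-*ₚ p r d))

*ₚ-cong : ∀ {p p′ r r′} → p ≋ p′ → r ≋ r′ → p *ₚ r ≋ p′ *ₚ r′
*ₚ-cong {p} {p′} {r} {r′} (mk≋ e) (mk≋ f) = mk≋ λ d →
  trans (coeff-*ₚ p r d) (trans (convolution-cong e f d) (sym (coeff-*ₚ p′ r′ d)))

*ₚ-zeroʳ : ∀ p → p *ₚ [] ≋ []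
*ₚ-zeroʳ []      = ≋-refl
*ₚ-zeroʳ (a ∷ p) = ≋-sym ([]≋0∷ (≋-sym (*ₚ-zeroʳ p)))

*ₚ-shiftʳ : ∀ p r → p *ₚ (+ 0 ∷ r) ≋ + 0 ∷ (p *ₚ r)
*ₚ-shiftʳ []      r = []≋0∷ ≋-refl
*ₚ-shiftʳ (a ∷ p) r =
  ∷-cong (trans (ℤP.+-identityʳ (a ℤ.* + 0)) (ℤP.*-zeroʳ a)) (+ₚ-cong ≋-refl (*ₚ-shiftʳ p r))

*ₚ-shiftˡ : ∀ p r → (+ 0 ∷ p) *ₚ r ≋ + 0 ∷ (p *ₚ r)
*ₚ-shiftˡ p r = +ₚ-cong (scaleₚ-zero r) ≋-refl

*ₚ-constʳ : ∀ p a → p *ₚ (a ∷ []) ≋ scaleₚ a p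
*ₚ-constʳ []      a = ≋-refl
*ₚ-constʳ (b ∷ p) a = ∷-cong (trans (ℤP.+-identityʳ (b ℤ.* a)) (ℤP.*-comm b a)) (*ₚ-constʳ p a)

+ₚ-interchange : ∀ a b c d → (a +ₚ b) +ₚ (c +ₚ d) ≋ (a +ₚ c) +ₚ (b +ₚ d)
+ₚ-interchange a b c d = mk≋ λ i → trans (coeff-+ₚ (a +ₚ b) _ i)
  (trans (cong₂ ℤ._+_ (coeff-+ₚ a b i) (coeff-+ₚ c d i))
  (trans (ℤ+.interchange (coeff a i) (coeff b i) (coeff c i) (coeff d i))
  (sym (trans (coeff-+ₚ (a +ₚ c) _ i) (cong₂ ℤ._+_ (coeff-+ₚ a c i) (coeff-+ₚ b d i))))))

*ₚ-distribˡ-+ₚ : ∀ r u v → r *ₚ (u +ₚ v) ≋ r *ₚ u +ₚ r *ₚ v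
*ₚ-distribˡ-+ₚ []      u v = ≋-refl
*ₚ-distribˡ-+ₚ (b ∷ r) u v =
  ≋-trans (+ₚ-cong (scaleₚ-distrib-+ₚ b u v) (∷-cong refl (*ₚ-distribˡ-+ₚ r u v)))
          (+ₚ-interchange (scaleₚ b u) (scaleₚ b v) (+ 0 ∷ (r *ₚ u)) (+ 0 ∷ (r *ₚ v)))

*ₚ-comm : ∀ p r → p *ₚ r ≋ r *ₚ p
*ₚ-comm []      r = ≋-sym (*ₚ-zeroʳ r)
*ₚ-comm (a ∷ p) r = ≋-sym (begin
  r *ₚ (a ∷ p)                       ≈⟨ *ₚ-cong (≋-refl {r}) (∷-cong (sym (ℤP.+-identityʳ a)) ≋-refl) ⟩
  r *ₚ ((a ∷ []) +ₚ (+ 0 ∷ p))       ≈⟨ *ₚ-distribˡ-+ₚ r (a ∷ []) (+ 0 ∷ p) ⟩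
  r *ₚ (a ∷ []) +ₚ r *ₚ (+ 0 ∷ p)    ≈⟨ +ₚ-cong (*ₚ-constʳ r a) (≋-trans (*ₚ-shiftʳ r p) (∷-cong refl (*ₚ-comm r p))) ⟩
  (a ∷ p) *ₚ r                       ∎)

*ₚ-distribʳ-+ₚ : ∀ r u v → (u +ₚ v) *ₚ r ≋ u *ₚ r +ₚ v *ₚ r
*ₚ-distribʳ-+ₚ r u v = ≋-trans (*ₚ-comm (u +ₚ v) r)
  (≋-trans (*ₚ-distribˡ-+ₚ r u v) (+ₚ-cong (*ₚ-comm r u) (*ₚ-comm r v)))

scaleₚ-*ₚ : ∀ a r s → scaleₚ a r *ₚ s ≋ scaleₚ a (r *ₚ s)
scaleₚ-*ₚ a []      s = ≋-refl
scaleₚ-*ₚ a (b ∷ r) s = ≋-trans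
  (+ₚ-cong (≋-sym (scaleₚ-scaleₚ a b s)) (∷-cong (sym (ℤP.*-zeroʳ a)) (scaleₚ-*ₚ a r s)))
  (≋-sym (scaleₚ-distrib-+ₚ a (scaleₚ b s) (+ 0 ∷ (r *ₚ s))))

*ₚ-assoc : ∀ p r s → (p *ₚ r) *ₚ s ≋ p *ₚ (r *ₚ s)
*ₚ-assoc []      r s = ≋-refl
*ₚ-assoc (a ∷ p) r s = ≋-trans (*ₚ-distribʳ-+ₚ s (scaleₚ a r) (+ 0 ∷ (p *ₚ r)))
  (+ₚ-cong (scaleₚ-*ₚ a r s) (≋-trans (*ₚ-shiftˡ (p *ₚ r) s) (∷-cong refl (*ₚ-assoc p r s))))

*ₚ-identityˡ : ∀ p → oneₚ *ₚ p ≋ p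
*ₚ-identityˡ p = ≋-trans (+ₚ-cong (scaleₚ-one p) (≋-sym ([]≋0∷ ≋-refl))) (+ₚ-identityʳ p)

*ₚ-identityʳ : ∀ p → p *ₚ oneₚ ≋ p
*ₚ-identityʳ p = ≋-trans (*ₚ-comm p oneₚ) (*ₚ-identityˡ p)

ℤ[q] : CommutativeRing _ _
ℤ[q] = record
  { Carrier = Poly ; _≈_ = _≋_ ; _+_ = _+ₚ_ ; _*_ = _*ₚ_ ; -_ = negₚ ; 0# = [] ; 1# = oneₚ
  ; isCommutativeRing = record
    { isRing = record
      { +-isAbelianGroup = record
        { isGroup = record
          { isMonoid = record
            { isSemigroup = record
              { isMagma = record { isEquivalence = ≋-isEquivalence ; ∙-cong = +ₚ-cong }
              ; assoc = +ₚ-assoc }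
            ; identity = (λ _ → ≋-refl) , +ₚ-identityʳ }
          ; inverse = +ₚ-inverseˡ , +ₚ-inverseʳ
          ; ⁻¹-cong = scaleₚ-cong (ℤ.- + 1) }
        ; comm = +ₚ-comm }
      ; *-cong = *ₚ-cong
      ; *-assoc = *ₚ-assoc
      ; *-identity = *ₚ-identityˡ , *ₚ-identityʳ
      ; distrib = *ₚ-distribˡ-+ₚ , *ₚ-distribʳ-+ₚ }
    ; *-comm = *ₚ-comm } }

zero? : (p : Poly) → Maybe ([] ≋ p)
zero? []      = just ≋-refl
zero? (a ∷ p) with a ℤ.≟ + 0 | zero? p
... | yes refl | just e = just ([]≋0∷ e)
... | _        | _      = nothing

ℤ[q]-solver : AlmostCommutativeRing _ _
ℤ[q]-solver = fromCommutativeRing ℤ[q] zero?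

*ₚ-congˡ : ∀ c {p r} → p ≋ r → c *ₚ p ≋ c *ₚ r
*ₚ-congˡ c = *ₚ-cong (≋-refl {c})

*ₚ-congʳ : ∀ c {p r} → p ≋ r → p *ₚ c ≋ r *ₚ c
*ₚ-congʳ c e = *ₚ-cong e (≋-refl {c})

+ₚ-congˡ : ∀ c {p r} → p ≋ r → c +ₚ p ≋ c +ₚ r
+ₚ-congˡ c = +ₚ-cong (≋-refl {c})

+ₚ-congʳ : ∀ c {p r} → p ≋ r → p +ₚ c ≋ r +ₚ c
+ₚ-congʳ c e = +ₚ-cong e (≋-refl {c})

*ₚ-absorbʳ : ∀ a {b} → b ≋ [] → a *ₚ b ≋ []
*ₚ-absorbʳ a e = ≋-trans (*ₚ-congˡ a e) (*ₚ-zeroʳ a)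

*ₚ-absorbˡ : ∀ b {a} → a ≋ [] → a *ₚ b ≋ []
*ₚ-absorbˡ b e = *ₚ-congʳ b e

scaleₚ≋const*ₚ : ∀ c p → scaleₚ c p ≋ (c ∷ []) *ₚ p
scaleₚ≋const*ₚ c p = ≋-sym (≋-trans (+ₚ-congˡ (scaleₚ c p) (≋-sym ([]≋0∷ ≋-refl))) (+ₚ-identityʳ (scaleₚ c p)))

∑ : ℕ → (ℕ → Poly) → Poly
∑ zero    f = []
∑ (suc n) f = ∑ n f +ₚ f n

infix 5 ∑
syntax ∑ n (λ i → e) = ∑[ i < n ] e

∑-cong : ∀ n {f g} → (∀ i → i < n → f i ≋ g i) → ∑ n f ≋ ∑ n g
∑-cong zero    e = ≋-refl
∑-cong (suc n) e = +ₚ-cong (∑-cong n λ i i<n → e i (ℕP.m<n⇒m<1+n i<n)) (e n ℕP.≤-refl)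

∑-zero : ∀ n {f} → (∀ i → i < n → f i ≋ []) → ∑ n f ≋ []
∑-zero zero    e = ≋-refl
∑-zero (suc n) e = +ₚ-cong (∑-zero n λ i i<n → e i (ℕP.m<n⇒m<1+n i<n)) (e n ℕP.≤-refl)

∑-suc : ∀ n f → ∑ (suc n) f ≋ f 0 +ₚ ∑ n (f ∘ suc)
∑-suc zero    f = ≋-sym (+ₚ-identityʳ (f 0))
∑-suc (suc n) f = ≋-trans (+ₚ-congʳ (f (suc n)) (∑-suc n f)) (+ₚ-assoc (f 0) _ _)

∑-+ : ∀ n d f → ∑ (n + d) f ≋ ∑ n f +ₚ (∑[ i < d ] f (n + i))
∑-+ n zero    f = ≋-trans (≡⇒≋ (cong (λ x → ∑ x f) (ℕP.+-identityʳ n))) (≋-sym (+ₚ-identityʳ _))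
∑-+ n (suc d) f = ≋-trans (≡⇒≋ (cong (λ x → ∑ x f) (ℕP.+-suc n d)))
  (≋-trans (+ₚ-congʳ (f (n + d)) (∑-+ n d f)) (+ₚ-assoc (∑ n f) _ _))

∑-+ₚ : ∀ n f g → ∑[ i < n ] (f i +ₚ g i) ≋ ∑ n f +ₚ ∑ n g
∑-+ₚ zero    f g = ≋-refl
∑-+ₚ (suc n) f g = ≋-trans (+ₚ-congʳ (f n +ₚ g n) (∑-+ₚ n f g)) (+ₚ-interchange (∑ n f) _ _ _)

∑-*ₚˡ : ∀ n c f → c *ₚ ∑ n f ≋ ∑[ i < n ] (c *ₚ f i)
∑-*ₚˡ zero    c f = *ₚ-zeroʳ c
∑-*ₚˡ (suc n) c f = ≋-trans (*ₚ-distribˡ-+ₚ c (∑ n f) (f n)) (+ₚ-congʳ (c *ₚ f n) (∑-*ₚˡ n c f))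

∑-scaleₚ : ∀ n c f → scaleₚ c (∑ n f) ≋ ∑[ i < n ] scaleₚ c (f i)
∑-scaleₚ zero    c f = ≋-refl
∑-scaleₚ (suc n) c f = ≋-trans (scaleₚ-distrib-+ₚ c (∑ n f) (f n)) (+ₚ-congʳ _ (∑-scaleₚ n c f))

∑-comm : ∀ n m (g : ℕ → ℕ → Poly) → ∑[ i < n ] ∑ m (g i) ≋ ∑[ j < m ] ∑[ i < n ] g i j
∑-comm zero    m g = ≋-sym (∑-zero m λ _ _ → ≋-refl)
∑-comm (suc n) m g = ≋-trans (+ₚ-congʳ (∑ m (g n)) (∑-comm n m g))
  (≋-sym (∑-+ₚ m (λ j → ∑[ i < n ] g i j) (g n)))

∑-reverse : ∀ n f → ∑ n f ≋ ∑[ i < n ] f (n ∸ suc i)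
∑-reverse zero    f = ≋-refl
∑-reverse (suc n) f = ≋-trans (+ₚ-comm (∑ n f) (f n))
  (≋-trans (+ₚ-congˡ (f n) (∑-reverse n f)) (≋-sym (∑-suc n (λ i → f (n ∸ i)))))

∑-trim : ∀ n d f → (∀ i → n ≤ i → f i ≋ []) → ∑ (n + d) f ≋ ∑ n f
∑-trim n d f e = ≋-trans (∑-+ n d f)
  (≋-trans (+ₚ-congˡ (∑ n f) (∑-zero d λ i _ → e (n + i) (ℕP.m≤m+n n i))) (+ₚ-identityʳ (∑ n f)))

∑-offset : ∀ κ n f → (∀ i → i < κ → f i ≋ []) → ∑ (κ + n) f ≋ ∑[ s < n ] f (κ + s)
∑-offset κ n f vanish = ≋-trans (∑-+ κ n f) (+ₚ-congʳ _ (∑-zero κ vanish))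

∑-⊓ : ∀ β γ (f : ℕ → Poly) → (∀ i → β < i → f i ≋ []) → ∑ (suc γ) f ≋ ∑ (suc (β ⊓ γ)) f
∑-⊓ β γ f vanish with ℕP.≤-total β γ
... | inj₂ γ≤β = ≡⇒≋ (cong (λ x → ∑ (suc x) f) (sym (ℕP.m≥n⇒m⊓n≡n γ≤β)))
... | inj₁ β≤γ with ℕP.m≤n⇒∃[o]m+o≡n β≤γ
...   | v , refl = ≋-trans (∑-trim (suc β) v f vanish)
                           (≡⇒≋ (cong (λ x → ∑ (suc x) f) (sym (ℕP.m≤n⇒m⊓n≡m β≤γ))))

sumₚ-applyUpTo : ∀ n (g : ℕ → Poly) (h : ℕ → ℕ) → sumₚ (map g (applyUpTo h n)) ≋ ∑[ i < n ] g (h i)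
sumₚ-applyUpTo zero    g h = ≋-refl
sumₚ-applyUpTo (suc n) g h = ≋-trans (+ₚ-congˡ (g (h 0)) (sumₚ-applyUpTo n g (h ∘ suc)))
  (≋-sym (∑-suc n (g ∘ h)))

qpow-+ : ∀ a b → qpow (a + b) ≋ qpow a *ₚ qpow b
qpow-+ zero    b = ≋-sym (*ₚ-identityˡ (qpow b))
qpow-+ (suc a) b = ≋-trans (∷-cong refl (qpow-+ a b)) (≋-sym (*ₚ-shiftˡ (qpow a) (qpow b)))

qpow-cong : ∀ {a b} → a ≡ b → qpow a ≋ qpow b
qpow-cong refl = ≋-refl

qbin-cong : ∀ {n n′ k k′} → n ≡ n′ → k ≡ k′ → qbin n k ≋ qbin n′ k′
qbin-cong refl refl = ≋-refl

qbin-congₙ : ∀ {n n′} k → n ≡ n′ → qbin n k ≋ qbin n′ k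
qbin-congₙ k refl = ≋-refl

qbin-congₖ : ∀ n {k k′} → k ≡ k′ → qbin n k ≋ qbin n k′
qbin-congₖ n refl = ≋-refl

qbin-> : ∀ {n k} → n < k → qbin n k ≋ []
qbin-> {zero}  {suc k} _         = ≋-refl
qbin-> {suc n} {suc k} (s≤s n<k) =
  ≋-trans (+ₚ-cong (qbin-> n<k) (*ₚ-absorbʳ (qpow (suc k)) (qbin-> (ℕP.m<n⇒m<1+n n<k)))) ≋-refl

qbin-diag : ∀ n → qbin n n ≋ oneₚ
qbin-diag zero    = ≋-refl
qbin-diag (suc n) =
  ≋-trans (+ₚ-cong (qbin-diag n) (*ₚ-absorbʳ (qpow (suc n)) (qbin-> {n} ℕP.≤-refl))) ≋-refl

qbin₂ : ℕ → ℕ → Poly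
qbin₂ a b = qbin (a + b) a

qbin₂-cong : ∀ {a a′ b b′} → a ≡ a′ → b ≡ b′ → qbin₂ a b ≋ qbin₂ a′ b′
qbin₂-cong refl refl = ≋-refl

qfact : ℕ → Poly
qfact zero    = oneₚ
qfact (suc n) = qfact n *ₚ (oneₚ +ₚ negₚ (qpow (suc n)))

qbin₂-qfact : ∀ a b → qbin₂ a b *ₚ (qfact a *ₚ qfact b) ≋ qfact (a + b)
qbin₂-qfact zero    b       = ≋-trans (*ₚ-identityˡ _) (*ₚ-identityˡ (qfact b))
qbin₂-qfact (suc a) zero    = begin
  qbin₂ (suc a) 0 *ₚ (qfact (suc a) *ₚ oneₚ) ≈⟨ *ₚ-cong (≋-trans (qbin-congₙ (suc a) (ℕP.+-identityʳ (suc a))) (qbin-diag (suc a)))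
                                                        (*ₚ-identityʳ (qfact (suc a))) ⟩
  oneₚ *ₚ qfact (suc a)                      ≈⟨ *ₚ-identityˡ _ ⟩
  qfact (suc a)                              ≡⟨ cong qfact (sym (ℕP.+-identityʳ (suc a))) ⟩
  qfact (suc a + 0)                          ∎
qbin₂-qfact (suc a) (suc b) = begin
  (qbin₂ a (suc b) +ₚ Qa *ₚ qbin (a + suc b) (suc a)) *ₚ ((qfact a *ₚ (oneₚ +ₚ negₚ Qa)) *ₚ (qfact b *ₚ (oneₚ +ₚ negₚ Qb)))
    ≈⟨ pascal-step (qbin₂ a (suc b)) (qbin (a + suc b) (suc a)) (qfact a) (qfact b) Qa Qb ⟩
  (oneₚ +ₚ negₚ Qa) *ₚ (qbin₂ a (suc b) *ₚ (qfact a *ₚ qfact (suc b)))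
    +ₚ (Qa *ₚ (oneₚ +ₚ negₚ Qb)) *ₚ (qbin (a + suc b) (suc a) *ₚ (qfact (suc a) *ₚ qfact b))
    ≈⟨ +ₚ-cong (*ₚ-congˡ (oneₚ +ₚ negₚ Qa) (qbin₂-qfact a (suc b))) (*ₚ-congˡ (Qa *ₚ (oneₚ +ₚ negₚ Qb)) shifted) ⟩
  (oneₚ +ₚ negₚ Qa) *ₚ qfact (a + suc b) +ₚ (Qa *ₚ (oneₚ +ₚ negₚ Qb)) *ₚ qfact (a + suc b)
    ≈⟨ collect (qfact (a + suc b)) Qa Qb ⟩
  qfact (a + suc b) *ₚ (oneₚ +ₚ negₚ (Qa *ₚ Qb))
    ≈⟨ *ₚ-congˡ (qfact (a + suc b)) (+ₚ-congˡ oneₚ (scaleₚ-cong (ℤ.- + 1) (≋-sym (qpow-+ (suc a) (suc b))))) ⟩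
  qfact (suc a + suc b) ∎
  where
  Qa = qpow (suc a)
  Qb = qpow (suc b)
  pascal-step : ∀ B₁ B₂ Fa Fb qa qb →
    (B₁ +ₚ qa *ₚ B₂) *ₚ ((Fa *ₚ (oneₚ +ₚ negₚ qa)) *ₚ (Fb *ₚ (oneₚ +ₚ negₚ qb))) ≋
    (oneₚ +ₚ negₚ qa) *ₚ (B₁ *ₚ (Fa *ₚ (Fb *ₚ (oneₚ +ₚ negₚ qb))))
      +ₚ (qa *ₚ (oneₚ +ₚ negₚ qb)) *ₚ (B₂ *ₚ ((Fa *ₚ (oneₚ +ₚ negₚ qa)) *ₚ Fb))
  pascal-step = solve-∀ ℤ[q]-solver
  collect : ∀ F qa qb → (oneₚ +ₚ negₚ qa) *ₚ F +ₚ (qa *ₚ (oneₚ +ₚ negₚ qb)) *ₚ F ≋ F *ₚ (oneₚ +ₚ negₚ (qa *ₚ qb))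
  collect = solve-∀ ℤ[q]-solver
  shifted : qbin (a + suc b) (suc a) *ₚ (qfact (suc a) *ₚ qfact b) ≋ qfact (a + suc b)
  shifted = subst (λ x → qbin x (suc a) *ₚ (qfact (suc a) *ₚ qfact b) ≋ qfact x)
                  (sym (ℕP.+-suc a b)) (qbin₂-qfact (suc a) b)

record Unit₀ (p : Poly) : Set where
  constructor unit₀
  field coeff₀≡1 : coeff p 0 ≡ + 1
open Unit₀

unit₀-*ₚ : ∀ {p r} → Unit₀ p → Unit₀ r → Unit₀ (p *ₚ r)
unit₀-*ₚ {p} {r} (unit₀ e) (unit₀ f) = unit₀ (trans (coeff-*ₚ p r 0) (cong₂ ℤ._*_ e f))

unit₀-qfact : ∀ n → Unit₀ (qfact n)
unit₀-qfact zero    = unit₀ refl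
unit₀-qfact (suc n) = unit₀-*ₚ (unit₀-qfact n) (unit₀ refl)

*ₚ-noZeroDivisorˡ : ∀ {p w} → Unit₀ p → p *ₚ w ≋ [] → w ≋ []
*ₚ-noZeroDivisorˡ {p} {w} p₀ e = mk≋ (go w e)
  where
  go : ∀ w → p *ₚ w ≋ [] → ∀ d → coeff w d ≡ coeff [] d
  go []      _       d       = refl
  go (b ∷ t) (mk≋ e) zero    = trans (sym (ℤP.*-identityˡ b))
    (trans (cong (ℤ._* b) (sym (coeff₀≡1 p₀))) (trans (sym (coeff-*ₚ p (b ∷ t) 0)) (e 0)))
  go (b ∷ t) e       (suc d) = go t (mk≋ λ i → coeff-≡ shifted (suc i)) d
    where
    shifted : + 0 ∷ (p *ₚ t) ≋ []
    shifted = ≋-trans (≋-sym (*ₚ-shiftʳ p t)) (≋-trans (*ₚ-congˡ p (∷-cong (sym (go (b ∷ t) e 0)) ≋-refl)) e)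

*ₚ-cancelˡ : ∀ {p u v} → Unit₀ p → p *ₚ u ≋ p *ₚ v → u ≋ v
*ₚ-cancelˡ {p} {u} {v} p₀ e = begin
  u                       ≈⟨ split u v ⟩
  (u +ₚ negₚ v) +ₚ v      ≈⟨ +ₚ-congʳ v (*ₚ-noZeroDivisorˡ p₀ difference) ⟩
  v                       ∎
  where
  split : ∀ u v → u ≋ (u +ₚ negₚ v) +ₚ v
  split = solve-∀ ℤ[q]-solver
  distrib : ∀ p u v → p *ₚ (u +ₚ negₚ v) ≋ p *ₚ u +ₚ negₚ (p *ₚ v)
  distrib = solve-∀ ℤ[q]-solver
  difference : p *ₚ (u +ₚ negₚ v) ≋ []
  difference = ≋-trans (distrib p u v) (≋-trans (+ₚ-congʳ _ e) (+ₚ-inverseʳ (p *ₚ v)))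

qbin₂-comm : ∀ a b → qbin₂ a b ≋ qbin₂ b a
qbin₂-comm a b = *ₚ-cancelˡ (unit₀-*ₚ (unit₀-qfact a) (unit₀-qfact b)) (begin
  (qfact a *ₚ qfact b) *ₚ qbin₂ a b ≈⟨ *ₚ-comm (qfact a *ₚ qfact b) (qbin₂ a b) ⟩
  qbin₂ a b *ₚ (qfact a *ₚ qfact b) ≈⟨ qbin₂-qfact a b ⟩
  qfact (a + b)                     ≡⟨ cong qfact (ℕP.+-comm a b) ⟩
  qfact (b + a)                     ≈⟨ ≋-sym (qbin₂-qfact b a) ⟩
  qbin₂ b a *ₚ (qfact b *ₚ qfact a) ≈⟨ ≋-trans (*ₚ-comm (qbin₂ b a) _) (*ₚ-congʳ (qbin₂ b a) (*ₚ-comm (qfact b) (qfact a))) ⟩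
  (qfact a *ₚ qfact b) *ₚ qbin₂ b a ∎)

qbin₂-trinomial : ∀ x y z → qbin₂ x (y + z) *ₚ qbin₂ y z ≋ qbin₂ (x + y) z *ₚ qbin₂ x y
qbin₂-trinomial x y z = *ₚ-cancelˡ (unit₀-*ₚ (unit₀-qfact x) (unit₀-*ₚ (unit₀-qfact y) (unit₀-qfact z))) (begin
  D *ₚ (qbin₂ x (y + z) *ₚ qbin₂ y z)
    ≈⟨ regroupˡ (qfact x) (qfact y) (qfact z) (qbin₂ x (y + z)) (qbin₂ y z) ⟩
  qbin₂ x (y + z) *ₚ (qfact x *ₚ (qbin₂ y z *ₚ (qfact y *ₚ qfact z)))
    ≈⟨ *ₚ-congˡ (qbin₂ x (y + z)) (*ₚ-congˡ (qfact x) (qbin₂-qfact y z)) ⟩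
  qbin₂ x (y + z) *ₚ (qfact x *ₚ qfact (y + z))
    ≈⟨ qbin₂-qfact x (y + z) ⟩
  qfact (x + (y + z))
    ≡⟨ cong qfact (sym (ℕP.+-assoc x y z)) ⟩
  qfact ((x + y) + z)
    ≈⟨ ≋-sym (qbin₂-qfact (x + y) z) ⟩
  qbin₂ (x + y) z *ₚ (qfact (x + y) *ₚ qfact z)
    ≈⟨ *ₚ-congˡ (qbin₂ (x + y) z) (*ₚ-congʳ (qfact z) (≋-sym (qbin₂-qfact x y))) ⟩
  qbin₂ (x + y) z *ₚ ((qbin₂ x y *ₚ (qfact x *ₚ qfact y)) *ₚ qfact z)
    ≈⟨ regroupʳ (qfact x) (qfact y) (qfact z) (qbin₂ (x + y) z) (qbin₂ x y) ⟩
  D *ₚ (qbin₂ (x + y) z *ₚ qbin₂ x y) ∎)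
  where
  D = qfact x *ₚ (qfact y *ₚ qfact z)
  regroupˡ : ∀ a b c u v → (a *ₚ (b *ₚ c)) *ₚ (u *ₚ v) ≋ u *ₚ (a *ₚ (v *ₚ (b *ₚ c)))
  regroupˡ = solve-∀ ℤ[q]-solver
  regroupʳ : ∀ a b c u v → u *ₚ ((v *ₚ (a *ₚ b)) *ₚ c) ≋ (a *ₚ (b *ₚ c)) *ₚ (u *ₚ v)
  regroupʳ = solve-∀ ℤ[q]-solver

vandermonde-term : ℕ → ℕ → ℕ → ℕ → Poly
vandermonde-term M N t s = qpow ((M ∸ s) ℕ.* (t ∸ s)) *ₚ (qbin M s *ₚ qbin N (t ∸ s))

vandermonde-term-pascal : ∀ M N t s → s ≤ t →
  qpow ((M ∸ s) ℕ.* (t ∸ s)) *ₚ ((qbin M s +ₚ qpow (suc s) *ₚ qbin M (suc s)) *ₚ qbin N (t ∸ s))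
    ≋ vandermonde-term M N t s +ₚ qpow (suc t) *ₚ vandermonde-term M N (suc t) (suc s)
vandermonde-term-pascal M N t s s≤t with suc s ℕ.≤? M
... | yes s<M = ≋-trans (expand E (qbin M s) (qpow (suc s)) (qbin M (suc s)) (qbin N (t ∸ s)))
  (+ₚ-congˡ (vandermonde-term M N t s) (≋-trans
    (*ₚ-congʳ (qbin M (suc s) *ₚ qbin N (t ∸ s)) (≋-trans (≋-sym (qpow-+ _ (suc s)))
      (≋-trans (qpow-cong (exponent s<M)) (qpow-+ (suc t) ((M ∸ suc s) ℕ.* (t ∸ s))))))
    (*ₚ-assoc (qpow (suc t)) (qpow ((M ∸ suc s) ℕ.* (t ∸ s))) (qbin M (suc s) *ₚ qbin N (t ∸ s)))))
  where
  E = qpow ((M ∸ s) ℕ.* (t ∸ s))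
  expand : ∀ e a q b n → e *ₚ ((a +ₚ q *ₚ b) *ₚ n) ≋ e *ₚ (a *ₚ n) +ₚ (e *ₚ q) *ₚ (b *ₚ n)
  expand = solve-∀ ℤ[q]-solver
  exponent : s < M → (M ∸ s) ℕ.* (t ∸ s) + suc s ≡ suc t + (M ∸ suc s) ℕ.* (t ∸ s)
  exponent s<M = trans (cong (λ x → x ℕ.* (t ∸ s) + suc s) (ℕP.+-∸-assoc 1 s<M))
    (trans (identity s (M ∸ suc s) (t ∸ s)) (cong (λ x → suc x + (M ∸ suc s) ℕ.* (t ∸ s)) (ℕP.m+[n∸m]≡n s≤t)))
    where
    identity : ∀ s x y → suc x ℕ.* y + suc s ≡ suc (s + y) + x ℕ.* y
    identity = ℕ-Solver.solve-∀
... | no s≮M = begin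
  E *ₚ ((qbin M s +ₚ qpow (suc s) *ₚ qbin M (suc s)) *ₚ qbin N (t ∸ s))
    ≈⟨ *ₚ-congˡ E (*ₚ-congʳ (qbin N (t ∸ s))
         (≋-trans (+ₚ-congˡ (qbin M s) (*ₚ-absorbʳ (qpow (suc s)) M<s+1)) (+ₚ-identityʳ (qbin M s)))) ⟩
  vandermonde-term M N t s
    ≈⟨ ≋-sym (+ₚ-identityʳ _) ⟩
  vandermonde-term M N t s +ₚ []
    ≈⟨ +ₚ-congˡ (vandermonde-term M N t s) (≋-sym (*ₚ-absorbʳ (qpow (suc t))
         (*ₚ-absorbʳ (qpow ((M ∸ suc s) ℕ.* (t ∸ s))) (*ₚ-congʳ (qbin N (t ∸ s)) M<s+1)))) ⟩
  vandermonde-term M N t s +ₚ qpow (suc t) *ₚ vandermonde-term M N (suc t) (suc s) ∎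
  where
  E = qpow ((M ∸ s) ℕ.* (t ∸ s))
  M<s+1 : qbin M (suc s) ≋ []
  M<s+1 = qbin-> (ℕP.≰⇒> s≮M)

q-vandermonde : ∀ M N t → qbin (M + N) t ≋ ∑[ s < suc t ] vandermonde-term M N t s
q-vandermonde zero    N t       = ≋-sym (≋-trans (∑-suc t (vandermonde-term 0 N t))
  (≋-trans (+ₚ-congˡ (vandermonde-term 0 N t 0) (∑-zero t λ i _ → *ₚ-absorbʳ (qpow (0 ℕ.* (t ∸ suc i))) {qbin 0 (suc i) *ₚ qbin N (t ∸ suc i)} ≋-refl))
  (≋-trans (+ₚ-identityʳ _) (≋-trans (*ₚ-identityˡ _) (*ₚ-identityˡ _)))))
q-vandermonde (suc M) N zero    = ≋-sym (≋-trans
  (*ₚ-congʳ (oneₚ *ₚ oneₚ) (qpow-cong (ℕP.*-zeroʳ (suc M)))) (≋-trans (*ₚ-identityˡ _) (*ₚ-identityˡ _)))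
q-vandermonde (suc M) N (suc t) = begin
  qbin (M + N) t +ₚ qpow (suc t) *ₚ qbin (M + N) (suc t)
    ≈⟨ +ₚ-cong (q-vandermonde M N t) (*ₚ-congˡ (qpow (suc t)) (≋-trans (q-vandermonde M N (suc t)) (∑-suc (suc t) B))) ⟩
  ΣA +ₚ qpow (suc t) *ₚ (B 0 +ₚ ΣB)
    ≈⟨ rearrange ΣA (qpow (suc t)) (B 0) ΣB ⟩
  qpow (suc t) *ₚ B 0 +ₚ (ΣA +ₚ qpow (suc t) *ₚ ΣB)
    ≈⟨ +ₚ-cong first (≋-sym (≋-trans (∑-+ₚ (suc t) (vandermonde-term M N t) (λ s → qpow (suc t) *ₚ B (suc s)))
                                    (+ₚ-congˡ ΣA (≋-sym (∑-*ₚˡ (suc t) (qpow (suc t)) (B ∘ suc)))))) ⟩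
  C 0 +ₚ (∑[ s < suc t ] (vandermonde-term M N t s +ₚ qpow (suc t) *ₚ B (suc s)))
    ≈⟨ +ₚ-congˡ (C 0) (∑-cong (suc t) λ s s<t → ≋-sym (vandermonde-term-pascal M N t s (ℕP.≤-pred s<t))) ⟩
  C 0 +ₚ ∑ (suc t) (C ∘ suc)
    ≈⟨ ≋-sym (∑-suc (suc t) C) ⟩
  ∑ (suc (suc t)) C ∎
  where
  B = vandermonde-term M N (suc t)
  C = vandermonde-term (suc M) N (suc t)
  ΣA = ∑ (suc t) (vandermonde-term M N t)
  ΣB = ∑ (suc t) (B ∘ suc)
  rearrange : ∀ a q b c → a +ₚ q *ₚ (b +ₚ c) ≋ q *ₚ b +ₚ (a +ₚ q *ₚ c)
  rearrange = solve-∀ ℤ[q]-solver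
  first : qpow (suc t) *ₚ B 0 ≋ C 0
  first = ≋-trans (≋-sym (*ₚ-assoc (qpow (suc t)) (qpow (M ℕ.* suc t)) _))
                  (*ₚ-congʳ (oneₚ *ₚ qbin N (suc t)) (≋-sym (qpow-+ (suc t) (M ℕ.* suc t))))

q-vandermonde′ : ∀ M D t →
  qbin (M + (D + t)) t ≋ ∑[ s < suc t ] qpow (s ℕ.* (D + s)) *ₚ (qbin M s *ₚ qbin (D + t) (t ∸ s))
q-vandermonde′ M D t = begin
  qbin (M + (D + t)) t                                 ≈⟨ qbin-congₙ t (ℕP.+-comm M (D + t)) ⟩
  qbin ((D + t) + M) t                                 ≈⟨ q-vandermonde (D + t) M t ⟩
  ∑ (suc t) (vandermonde-term (D + t) M t)             ≈⟨ ∑-reverse (suc t) (vandermonde-term (D + t) M t) ⟩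
  ∑[ i < suc t ] vandermonde-term (D + t) M t (t ∸ i)  ≈⟨ ∑-cong (suc t) reindex ⟩
  ∑[ s < suc t ] qpow (s ℕ.* (D + s)) *ₚ (qbin M s *ₚ qbin (D + t) (t ∸ s)) ∎
  where
  reindex : ∀ i → i < suc t →
    vandermonde-term (D + t) M t (t ∸ i) ≋ qpow (i ℕ.* (D + i)) *ₚ (qbin M i *ₚ qbin (D + t) (t ∸ i))
  reindex i (s≤s i≤t) with ℕP.m≤n⇒∃[o]m+o≡n i≤t
  ... | v , refl = *ₚ-cong (qpow-cong exponent)
    (≋-trans (*ₚ-congˡ (qbin (D + (i + v)) (i + v ∸ i)) (qbin-congₖ M (ℕP.m∸[m∸n]≡n i≤t)))
             (*ₚ-comm (qbin (D + (i + v)) (i + v ∸ i)) (qbin M i)))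
    where
    exponent : (D + (i + v) ∸ (i + v ∸ i)) ℕ.* (i + v ∸ (i + v ∸ i)) ≡ i ℕ.* (D + i)
    exponent rewrite ℕP.m+n∸m≡n i v | ℕP.m+n∸n≡m i v =
      trans (cong (ℕ._* i) (trans (cong (_∸ v) (sym (ℕP.+-assoc D i v))) (ℕP.m+n∸n≡m (D + i) v)))
            (ℕP.*-comm (D + i) i)

-- With ε = true the reduction consumes one factor q^(k²) of q^(j k²), lowering j by one.
extra : Bool → ℕ → ℕ
extra true  κ = κ ℕ.* κ
extra false κ = 0

weightExp : Bool → ℕ → ℕ → ℕ → ℕ
weightExp true  b c r = r ℕ.* r
weightExp false b c r = (b ∸ r) ℕ.* (c ∸ r)

middle-term : Bool → ℕ → ℕ → ℕ → ℕ → Poly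
middle-term ε κ β γ s =
  qpow (weightExp ε (κ + β) (κ + γ) (κ + s)) *ₚ (qbin β s *ₚ qbin ((κ + κ) + γ) (γ ∸ s))

middle-expansion : ∀ ε κ β γ →
  qpow (extra ε κ) *ₚ qbin (β + ((κ + κ) + γ)) γ ≋ ∑ (suc (β ⊓ γ)) (middle-term ε κ β γ)
middle-expansion ε κ β γ = ≋-trans (full ε) (∑-⊓ β γ (middle-term ε κ β γ) λ i β<i →
  *ₚ-absorbʳ (qpow (weightExp ε (κ + β) (κ + γ) (κ + i))) (*ₚ-congʳ (qbin ((κ + κ) + γ) (γ ∸ i)) (qbin-> β<i)))
  where
  full : ∀ ε → qpow (extra ε κ) *ₚ qbin (β + ((κ + κ) + γ)) γ ≋ ∑ (suc γ) (middle-term ε κ β γ)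
  full false = ≋-trans (*ₚ-identityˡ _) (≋-trans (q-vandermonde β ((κ + κ) + γ) γ) (∑-cong (suc γ) λ s _ →
    *ₚ-congʳ (qbin β s *ₚ qbin ((κ + κ) + γ) (γ ∸ s))
      (qpow-cong (sym (cong₂ ℕ._*_ (ℕP.[m+n]∸[m+o]≡n∸o κ β s) (ℕP.[m+n]∸[m+o]≡n∸o κ γ s))))))
  full true = ≋-trans (*ₚ-congˡ (qpow (κ ℕ.* κ)) (q-vandermonde′ β (κ + κ) γ))
    (≋-trans (∑-*ₚˡ (suc γ) (qpow (κ ℕ.* κ)) _) (∑-cong (suc γ) λ s _ →
      ≋-trans (≋-sym (*ₚ-assoc (qpow (κ ℕ.* κ)) (qpow (s ℕ.* ((κ + κ) + s))) _))
        (*ₚ-congʳ (qbin β s *ₚ qbin ((κ + κ) + γ) (γ ∸ s))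
          (≋-trans (≋-sym (qpow-+ (κ ℕ.* κ) (s ℕ.* ((κ + κ) + s)))) (qpow-cong (square κ s))))))
    where
    square : ∀ κ s → κ ℕ.* κ + s ℕ.* ((κ + κ) + s) ≡ (κ + s) ℕ.* (κ + s)
    square = ℕ-Solver.solve-∀

edge : ℕ → ℕ → ℤ → Poly
edge a b k = qbinℤ (a + b) (+ a ℤ.+ k)

edge-> : ∀ a {b κ} → b < κ → edge a b (+ κ) ≋ []
edge-> a b<κ = qbin-> (ℕP.+-monoʳ-< a b<κ)

edge-mirror : ∀ a b κ → edge a b -[1+ κ ] ≋ edge b a (+ suc κ)
edge-mirror a b κ with suc κ ℕ.≤? a
... | yes sκ≤a with ℕP.m≤n⇒∃[o]m+o≡n sκ≤a
...   | u , refl = begin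
  qbinℤ ((suc κ + u) + b) (+ (suc κ + u) ℤ.+ -[1+ κ ])
    ≡⟨ cong (qbinℤ ((suc κ + u) + b)) (trans (ℤP.⊖-≥ sκ≤a) (cong +_ (ℕP.m+n∸m≡n (suc κ) u))) ⟩
  qbin ((suc κ + u) + b) u ≡⟨ cong (λ x → qbin x u) (reassoc κ u b) ⟩
  qbin₂ u (suc κ + b)      ≈⟨ qbin₂-comm u (suc κ + b) ⟩
  qbin₂ (suc κ + b) u      ≈⟨ qbin-cong (reassoc′ κ u b) (ℕP.+-comm (suc κ) b) ⟩
  edge b (suc κ + u) (+ suc κ) ∎
  where
  reassoc : ∀ κ u b → (suc κ + u) + b ≡ u + (suc κ + b)
  reassoc = ℕ-Solver.solve-∀
  reassoc′ : ∀ κ u b → (suc κ + b) + u ≡ b + (suc κ + u)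
  reassoc′ = ℕ-Solver.solve-∀
edge-mirror a b κ | no sκ≰a = begin
  qbinℤ (a + b) (+ a ℤ.+ -[1+ κ ]) ≡⟨ cong (qbinℤ (a + b)) negative ⟩
  qbinℤ (a + b) -[1+ κ ∸ a ]       ≈⟨ ≋-sym (edge-> b (ℕP.≰⇒> sκ≰a)) ⟩
  edge b a (+ suc κ)               ∎
  where
  negative : + a ℤ.+ -[1+ κ ] ≡ -[1+ κ ∸ a ]
  negative = trans (ℤP.⊖-< (ℕP.≰⇒> sκ≰a)) (cong (λ x → ℤ.- + x) (ℕP.+-∸-assoc 1 (ℕP.≤-pred (ℕP.≰⇒> sκ≰a))))

edge-trinomialˡ : ∀ a κ s u →
  edge a (κ + (s + u)) (+ κ) *ₚ qbin (s + u) s ≋ qbin (a + (κ + (s + u))) u *ₚ edge a (κ + s) (+ κ)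
edge-trinomialˡ a κ s u = begin
  qbin (a + (κ + (s + u))) (a + κ) *ₚ qbin (s + u) s
    ≈⟨ *ₚ-congʳ (qbin (s + u) s) (qbin-congₙ (a + κ) (e₁ a κ s u)) ⟩
  qbin₂ (a + κ) (s + u) *ₚ qbin₂ s u
    ≈⟨ qbin₂-trinomial (a + κ) s u ⟩
  qbin₂ ((a + κ) + s) u *ₚ qbin₂ (a + κ) s
    ≈⟨ *ₚ-cong (≋-trans (qbin₂-comm ((a + κ) + s) u) (qbin-congₙ u (e₂ a κ s u)))
               (qbin-congₙ (a + κ) (ℕP.+-assoc a κ s)) ⟩
  qbin (a + (κ + (s + u))) u *ₚ qbin (a + (κ + s)) (a + κ) ∎
  where
  e₁ : ∀ a κ s u → a + (κ + (s + u)) ≡ (a + κ) + (s + u)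
  e₁ = ℕ-Solver.solve-∀
  e₂ : ∀ a κ s u → u + ((a + κ) + s) ≡ a + (κ + (s + u))
  e₂ = ℕ-Solver.solve-∀

edge-trinomialʳ : ∀ κ s w δ →
  edge (κ + (s + w)) (κ + δ) (+ κ) *ₚ qbin ((κ + κ) + (s + w)) w
    ≋ qbin ((κ + (s + w)) + (κ + δ)) w *ₚ edge (κ + s) (κ + δ) (+ κ)
edge-trinomialʳ κ s w δ = begin
  qbin ((κ + (s + w)) + (κ + δ)) ((κ + (s + w)) + κ) *ₚ qbin ((κ + κ) + (s + w)) w
    ≈⟨ *ₚ-cong (qbin-cong (e₁ κ s w δ) (e₂ κ s w))
               (qbin-congₙ w (e₃ κ s w)) ⟩
  qbin₂ (w + y) δ *ₚ qbin₂ w y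
    ≈⟨ ≋-sym (qbin₂-trinomial w y δ) ⟩
  qbin₂ w (y + δ) *ₚ qbin₂ y δ
    ≈⟨ *ₚ-cong (qbin-congₙ w (e₄ κ s w δ))
               (qbin-cong (e₅ κ s δ) (e₆ κ s)) ⟩
  qbin ((κ + (s + w)) + (κ + δ)) w *ₚ qbin ((κ + s) + (κ + δ)) ((κ + s) + κ) ∎
  where
  y = (κ + κ) + s
  e₁ : ∀ κ s w δ → (κ + (s + w)) + (κ + δ) ≡ (w + ((κ + κ) + s)) + δ
  e₁ = ℕ-Solver.solve-∀
  e₂ : ∀ κ s w → (κ + (s + w)) + κ ≡ w + ((κ + κ) + s)
  e₂ = ℕ-Solver.solve-∀
  e₃ : ∀ κ s w → (κ + κ) + (s + w) ≡ w + ((κ + κ) + s)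
  e₃ = ℕ-Solver.solve-∀
  e₄ : ∀ κ s w δ → w + (((κ + κ) + s) + δ) ≡ (κ + (s + w)) + (κ + δ)
  e₄ = ℕ-Solver.solve-∀
  e₅ : ∀ κ s δ → ((κ + κ) + s) + δ ≡ (κ + s) + (κ + δ)
  e₅ = ℕ-Solver.solve-∀
  e₆ : ∀ κ s → (κ + κ) + s ≡ (κ + s) + κ
  e₆ = ℕ-Solver.solve-∀

edge-shifted : ∀ κ β γ → edge (κ + β) (κ + γ) (+ κ) ≋ qbin (β + ((κ + κ) + γ)) γ
edge-shifted κ β γ = begin
  qbin ((κ + β) + (κ + γ)) ((κ + β) + κ) ≈⟨ qbin-cong (e₁ κ β γ) (e₂ κ β) ⟩
  qbin₂ (β + (κ + κ)) γ                  ≈⟨ qbin₂-comm (β + (κ + κ)) γ ⟩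
  qbin₂ γ (β + (κ + κ))                  ≈⟨ qbin-congₙ γ (e₃ κ β γ) ⟩
  qbin (β + ((κ + κ) + γ)) γ             ∎
  where
  e₁ : ∀ κ β γ → (κ + β) + (κ + γ) ≡ (β + (κ + κ)) + γ
  e₁ = ℕ-Solver.solve-∀
  e₂ : ∀ κ β → (κ + β) + κ ≡ β + (κ + κ)
  e₂ = ℕ-Solver.solve-∀
  e₃ : ∀ κ β γ → γ + (β + (κ + κ)) ≡ β + ((κ + κ) + γ)
  e₃ = ℕ-Solver.solve-∀

-- Only evaluated at r ≤ b ⊓ c, where the truncated subtractions are exact.
weight : Bool → ℕ → ℕ → ℕ → ℕ → ℕ → Poly
weight ε a b c d r = qpow (weightExp ε b c r) *ₚ (qbin (a + b) (b ∸ r) *ₚ qbin (c + d) (c ∸ r))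

weight-reverse : ∀ ε a b c d r → weight ε d c b a r ≋ weight ε a b c d r
weight-reverse ε a b c d r = *ₚ-cong (qpow-cong (exponent ε))
  (≋-trans (*ₚ-comm (qbin (d + c) (c ∸ r)) (qbin (b + a) (b ∸ r)))
           (*ₚ-cong (qbin-congₙ (b ∸ r) (ℕP.+-comm b a)) (qbin-congₙ (c ∸ r) (ℕP.+-comm d c))))
  where
  exponent : ∀ ε → weightExp ε c b r ≡ weightExp ε b c r
  exponent true  = refl
  exponent false = ℕP.*-comm (c ∸ r) (b ∸ r)

triple-reduction-term : ∀ ε a κ s u w δ →
  (edge a (κ + (s + u)) (+ κ) *ₚ edge (κ + (s + w)) (κ + δ) (+ κ)) *ₚ middle-term ε κ (s + u) (s + w) s
    ≋ weight ε a (κ + (s + u)) (κ + (s + w)) (κ + δ) (κ + s) *ₚ (edge a (κ + s) (+ κ) *ₚ edge (κ + s) (κ + δ) (+ κ))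
triple-reduction-term ε a κ s u w δ = begin
  (L₁ *ₚ L₂) *ₚ (Q *ₚ (qbin (s + u) s *ₚ qbin ((κ + κ) + (s + w)) ((s + w) ∸ s)))
    ≈⟨ *ₚ-congˡ (L₁ *ₚ L₂) (*ₚ-congˡ Q (*ₚ-congˡ (qbin (s + u) s) (qbin-congₖ ((κ + κ) + (s + w)) (ℕP.m+n∸m≡n s w)))) ⟩
  (L₁ *ₚ L₂) *ₚ (Q *ₚ (qbin (s + u) s *ₚ qbin ((κ + κ) + (s + w)) w))
    ≈⟨ regroup L₁ L₂ Q (qbin (s + u) s) (qbin ((κ + κ) + (s + w)) w) ⟩
  Q *ₚ ((L₁ *ₚ qbin (s + u) s) *ₚ (L₂ *ₚ qbin ((κ + κ) + (s + w)) w))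
    ≈⟨ *ₚ-congˡ Q (*ₚ-cong (edge-trinomialˡ a κ s u) (edge-trinomialʳ κ s w δ)) ⟩
  Q *ₚ ((P₁ *ₚ R₁) *ₚ (P₂ *ₚ R₂))
    ≈⟨ regroup′ Q P₁ R₁ P₂ R₂ ⟩
  (Q *ₚ (P₁ *ₚ P₂)) *ₚ (R₁ *ₚ R₂)
    ≈⟨ *ₚ-congʳ (R₁ *ₚ R₂) (*ₚ-congˡ Q (*ₚ-cong (qbin-congₖ (a + (κ + (s + u))) (sym (cancel u))) (qbin-congₖ ((κ + (s + w)) + (κ + δ)) (sym (cancel w))))) ⟩
  weight ε a (κ + (s + u)) (κ + (s + w)) (κ + δ) (κ + s) *ₚ (R₁ *ₚ R₂) ∎
  where
  L₁ = edge a (κ + (s + u)) (+ κ)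
  L₂ = edge (κ + (s + w)) (κ + δ) (+ κ)
  Q = qpow (weightExp ε (κ + (s + u)) (κ + (s + w)) (κ + s))
  P₁ = qbin (a + (κ + (s + u))) u
  P₂ = qbin ((κ + (s + w)) + (κ + δ)) w
  R₁ = edge a (κ + s) (+ κ)
  R₂ = edge (κ + s) (κ + δ) (+ κ)
  cancel : ∀ x → (κ + (s + x)) ∸ (κ + s) ≡ x
  cancel x = trans (ℕP.[m+n]∸[m+o]≡n∸o κ (s + x) s) (ℕP.m+n∸m≡n s x)
  regroup : ∀ l₁ l₂ q x y → (l₁ *ₚ l₂) *ₚ (q *ₚ (x *ₚ y)) ≋ q *ₚ ((l₁ *ₚ x) *ₚ (l₂ *ₚ y))
  regroup = solve-∀ ℤ[q]-solver
  regroup′ : ∀ q p₁ r₁ p₂ r₂ → q *ₚ ((p₁ *ₚ r₁) *ₚ (p₂ *ₚ r₂)) ≋ (q *ₚ (p₁ *ₚ p₂)) *ₚ (r₁ *ₚ r₂)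
  regroup′ = solve-∀ ℤ[q]-solver

triple-vanishing : ∀ ε a b c d κ → edge a b (+ κ) *ₚ (edge b c (+ κ) *ₚ edge c d (+ κ)) ≋ [] →
  (∀ r → r < suc (b ⊓ c) → edge a r (+ κ) *ₚ edge r d (+ κ) ≋ []) →
  qpow (extra ε κ) *ₚ (edge a b (+ κ) *ₚ (edge b c (+ κ) *ₚ edge c d (+ κ)))
    ≋ ∑[ r < suc (b ⊓ c) ] weight ε a b c d r *ₚ (edge a r (+ κ) *ₚ edge r d (+ κ))
triple-vanishing ε a b c d κ lhs rhs = ≋-trans (*ₚ-absorbʳ (qpow (extra ε κ)) lhs)
  (≋-sym (∑-zero (suc (b ⊓ c)) λ r r< → *ₚ-absorbʳ (weight ε a b c d r) (rhs r r<)))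

triple-reduction⁺ : ∀ ε a b c d κ →
  qpow (extra ε κ) *ₚ (edge a b (+ κ) *ₚ (edge b c (+ κ) *ₚ edge c d (+ κ)))
    ≋ ∑[ r < suc (b ⊓ c) ] weight ε a b c d r *ₚ (edge a r (+ κ) *ₚ edge r d (+ κ))
triple-reduction⁺ ε a b c d κ with κ ℕ.≤? b | κ ℕ.≤? c | κ ℕ.≤? d
... | no κ≰b | _ | _ = triple-vanishing ε a b c d κ
  (*ₚ-absorbˡ _ (edge-> a (ℕP.≰⇒> κ≰b)))
  (λ r r≤b⊓c → *ₚ-absorbˡ _ (edge-> a (ℕP.≤-<-trans (ℕP.≤-trans (ℕP.≤-pred r≤b⊓c) (ℕP.m⊓n≤m b c)) (ℕP.≰⇒> κ≰b))))
... | yes _ | no κ≰c | _ = triple-vanishing ε a b c d κ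
  (*ₚ-absorbʳ (edge a b (+ κ)) (*ₚ-absorbˡ _ (edge-> b (ℕP.≰⇒> κ≰c))))
  (λ r r≤b⊓c → *ₚ-absorbˡ _ (edge-> a (ℕP.≤-<-trans (ℕP.≤-trans (ℕP.≤-pred r≤b⊓c) (ℕP.m⊓n≤n b c)) (ℕP.≰⇒> κ≰c))))
... | yes _ | yes _ | no κ≰d = triple-vanishing ε a b c d κ
  (*ₚ-absorbʳ (edge a b (+ κ)) (*ₚ-absorbʳ (edge b c (+ κ)) (edge-> c (ℕP.≰⇒> κ≰d))))
  (λ r _ → *ₚ-absorbʳ (edge a r (+ κ)) (edge-> r (ℕP.≰⇒> κ≰d)))
... | yes κ≤b | yes κ≤c | yes κ≤d
  with ℕP.m≤n⇒∃[o]m+o≡n κ≤b | ℕP.m≤n⇒∃[o]m+o≡n κ≤c | ℕP.m≤n⇒∃[o]m+o≡n κ≤d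
... | β , refl | γ , refl | δ , refl = begin
  E *ₚ (L₁ *ₚ (M *ₚ L₂))
    ≈⟨ regroup E L₁ M L₂ ⟩
  (L₁ *ₚ L₂) *ₚ (E *ₚ M)
    ≈⟨ *ₚ-congˡ (L₁ *ₚ L₂) (≋-trans (*ₚ-congˡ E (edge-shifted κ β γ)) (middle-expansion ε κ β γ)) ⟩
  (L₁ *ₚ L₂) *ₚ ∑ (suc (β ⊓ γ)) (middle-term ε κ β γ)
    ≈⟨ ∑-*ₚˡ (suc (β ⊓ γ)) (L₁ *ₚ L₂) (middle-term ε κ β γ) ⟩
  ∑[ s < suc (β ⊓ γ) ] (L₁ *ₚ L₂) *ₚ middle-term ε κ β γ s
    ≈⟨ ∑-cong (suc (β ⊓ γ)) term ⟩
  ∑[ s < suc (β ⊓ γ) ] T (κ + s)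
    ≈⟨ ≋-sym (∑-offset κ (suc (β ⊓ γ)) T λ r r<κ → *ₚ-absorbʳ (weight ε a (κ + β) (κ + γ) (κ + δ) r)
                                                      (*ₚ-absorbˡ (edge r (κ + δ) (+ κ)) (edge-> a r<κ))) ⟩
  ∑ (κ + suc (β ⊓ γ)) T
    ≡⟨ cong (λ x → ∑ x T) (trans (ℕP.+-suc κ (β ⊓ γ)) (cong suc (ℕP.+-distribˡ-⊓ κ β γ))) ⟩
  ∑ (suc ((κ + β) ⊓ (κ + γ))) T ∎
  where
  E = qpow (extra ε κ)
  L₁ = edge a (κ + β) (+ κ)
  M = edge (κ + β) (κ + γ) (+ κ)
  L₂ = edge (κ + γ) (κ + δ) (+ κ)
  T : ℕ → Poly
  T r = weight ε a (κ + β) (κ + γ) (κ + δ) r *ₚ (edge a r (+ κ) *ₚ edge r (κ + δ) (+ κ))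
  regroup : ∀ e l₁ m l₂ → e *ₚ (l₁ *ₚ (m *ₚ l₂)) ≋ (l₁ *ₚ l₂) *ₚ (e *ₚ m)
  regroup = solve-∀ ℤ[q]-solver
  term : ∀ s → s < suc (β ⊓ γ) → (L₁ *ₚ L₂) *ₚ middle-term ε κ β γ s ≋ T (κ + s)
  term s (s≤s s≤β⊓γ) with ℕP.m≤n⇒∃[o]m+o≡n (ℕP.≤-trans s≤β⊓γ (ℕP.m⊓n≤m β γ))
                        | ℕP.m≤n⇒∃[o]m+o≡n (ℕP.≤-trans s≤β⊓γ (ℕP.m⊓n≤n β γ))
  ... | u , refl | w , refl = triple-reduction-term ε a κ s u w δ

triple-reduction : ∀ ε a b c d k →
  qpow (extra ε ℤ.∣ k ∣) *ₚ (edge a b k *ₚ (edge b c k *ₚ edge c d k))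
    ≋ ∑[ r < suc (b ⊓ c) ] weight ε a b c d r *ₚ (edge a r k *ₚ edge r d k)
triple-reduction ε a b c d (+ κ)    = triple-reduction⁺ ε a b c d κ
triple-reduction ε a b c d -[1+ κ ] = begin
  E *ₚ (edge a b k *ₚ (edge b c k *ₚ edge c d k))
    ≈⟨ *ₚ-congˡ E (*ₚ-cong (edge-mirror a b κ) (*ₚ-cong (edge-mirror b c κ) (edge-mirror c d κ))) ⟩
  E *ₚ (edge b a K *ₚ (edge c b K *ₚ edge d c K))
    ≈⟨ *ₚ-congˡ E (reverse (edge b a K) (edge c b K) (edge d c K)) ⟩
  E *ₚ (edge d c K *ₚ (edge c b K *ₚ edge b a K))
    ≈⟨ triple-reduction⁺ ε d c b a (suc κ) ⟩
  ∑[ r < suc (c ⊓ b) ] weight ε d c b a r *ₚ (edge d r K *ₚ edge r a K)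
    ≡⟨ cong (λ x → ∑[ r < suc x ] weight ε d c b a r *ₚ (edge d r K *ₚ edge r a K)) (ℕP.⊓-comm c b) ⟩
  ∑[ r < suc (b ⊓ c) ] weight ε d c b a r *ₚ (edge d r K *ₚ edge r a K)
    ≈⟨ ∑-cong (suc (b ⊓ c)) (λ r _ → *ₚ-cong (weight-reverse ε a b c d r)
         (≋-trans (*ₚ-comm (edge d r K) (edge r a K)) (≋-sym (*ₚ-cong (edge-mirror a r κ) (edge-mirror r d κ))))) ⟩
  ∑[ r < suc (b ⊓ c) ] weight ε a b c d r *ₚ (edge a r k *ₚ edge r d k) ∎
  where
  k = -[1+ κ ]
  K = + suc κ
  E = qpow (extra ε (suc κ))
  reverse : ∀ x y z → x *ₚ (y *ₚ z) ≋ z *ₚ (y *ₚ x)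
  reverse = solve-∀ ℤ[q]-solver

qbin₂-quadrinomial : ∀ A s u w →
  qbin₂ (A + w) (s + u) *ₚ (qbin₂ s u *ₚ qbin₂ w A) ≋ qbin₂ w ((A + s) + u) *ₚ (qbin₂ (A + s) u *ₚ qbin₂ A s)
qbin₂-quadrinomial A s u w = begin
  qbin₂ (A + w) (s + u) *ₚ (qbin₂ s u *ₚ qbin₂ w A)
    ≈⟨ ≋-sym (*ₚ-assoc (qbin₂ (A + w) (s + u)) _ _) ⟩
  (qbin₂ (A + w) (s + u) *ₚ qbin₂ s u) *ₚ qbin₂ w A
    ≈⟨ *ₚ-congʳ (qbin₂ w A) (qbin₂-trinomial (A + w) s u) ⟩
  (qbin₂ ((A + w) + s) u *ₚ qbin₂ (A + w) s) *ₚ qbin₂ w A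
    ≈⟨ *ₚ-assoc (qbin₂ ((A + w) + s) u) _ _ ⟩
  qbin₂ ((A + w) + s) u *ₚ (qbin₂ (A + w) s *ₚ qbin₂ w A)
    ≈⟨ *ₚ-congˡ (qbin₂ ((A + w) + s) u) (≋-trans (*ₚ-congʳ (qbin₂ w A) (qbin₂-cong (ℕP.+-comm A w) refl))
                                                 (≋-sym (qbin₂-trinomial w A s))) ⟩
  qbin₂ ((A + w) + s) u *ₚ (qbin₂ w (A + s) *ₚ qbin₂ A s)
    ≈⟨ ≋-sym (*ₚ-assoc (qbin₂ ((A + w) + s) u) _ _) ⟩
  (qbin₂ ((A + w) + s) u *ₚ qbin₂ w (A + s)) *ₚ qbin₂ A s
    ≈⟨ *ₚ-congʳ (qbin₂ A s) (≋-trans (*ₚ-congʳ (qbin₂ w (A + s)) (qbin₂-cong (reassoc A s w) refl))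
                                     (≋-sym (qbin₂-trinomial w (A + s) u))) ⟩
  (qbin₂ w ((A + s) + u) *ₚ qbin₂ (A + s) u) *ₚ qbin₂ A s
    ≈⟨ *ₚ-assoc (qbin₂ w ((A + s) + u)) _ _ ⟩
  qbin₂ w ((A + s) + u) *ₚ (qbin₂ (A + s) u *ₚ qbin₂ A s) ∎
  where
  reassoc : ∀ A s w → (A + w) + s ≡ w + (A + s)
  reassoc = ℕ-Solver.solve-∀

pairWeight : Bool → ℕ → ℕ → ℕ → Poly
pairWeight ε n b r = qpow (weightExp ε b n r) *ₚ (qbin (n + b) (n ∸ r) *ₚ qbin (b + r) (r + r))

pair-reduction-term : ∀ ε κ s u w →
  edge (κ + (s + w)) (κ + (s + u)) (+ κ) *ₚ middle-term ε κ (s + u) (s + w) s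
    ≋ pairWeight ε (κ + (s + w)) (κ + (s + u)) (κ + s) *ₚ edge (κ + s) (κ + s) (+ κ)
pair-reduction-term ε κ s u w = begin
  L *ₚ (Q *ₚ (qbin₂ s u *ₚ qbin ((κ + κ) + (s + w)) ((s + w) ∸ s)))
    ≈⟨ *ₚ-cong (qbin-cong (e₁ κ s u w) (e₂ κ s w))
               (*ₚ-congˡ Q (*ₚ-congˡ (qbin₂ s u) (qbin-cong (e₃ κ s w) (ℕP.m+n∸m≡n s w)))) ⟩
  qbin₂ (A + w) (s + u) *ₚ (Q *ₚ (qbin₂ s u *ₚ qbin₂ w A))
    ≈⟨ commute (qbin₂ (A + w) (s + u)) Q (qbin₂ s u *ₚ qbin₂ w A) ⟩
  Q *ₚ (qbin₂ (A + w) (s + u) *ₚ (qbin₂ s u *ₚ qbin₂ w A))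
    ≈⟨ *ₚ-congˡ Q (qbin₂-quadrinomial A s u w) ⟩
  Q *ₚ (qbin₂ w ((A + s) + u) *ₚ (qbin₂ (A + s) u *ₚ qbin₂ A s))
    ≈⟨ *ₚ-congˡ Q (*ₚ-cong (qbin-cong (e₄ κ s u w) (sym (cancel w)))
                           (*ₚ-cong (qbin-cong (e₅ κ s u) (e₆ κ s)) (qbin-cong (e₆ κ s) (e₇ κ s)))) ⟩
  Q *ₚ (qbin (n + b) (n ∸ r) *ₚ (qbin (b + r) (r + r) *ₚ edge r r (+ κ)))
    ≈⟨ reassoc Q (qbin (n + b) (n ∸ r)) (qbin (b + r) (r + r)) (edge r r (+ κ)) ⟩
  pairWeight ε n b r *ₚ edge r r (+ κ) ∎
  where
  A = (κ + κ) + s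
  n = κ + (s + w)
  b = κ + (s + u)
  r = κ + s
  L = edge n b (+ κ)
  Q = qpow (weightExp ε b n r)
  cancel : ∀ x → (κ + (s + x)) ∸ (κ + s) ≡ x
  cancel x = trans (ℕP.[m+n]∸[m+o]≡n∸o κ (s + x) s) (ℕP.m+n∸m≡n s x)
  commute : ∀ x q y → x *ₚ (q *ₚ y) ≋ q *ₚ (x *ₚ y)
  commute = solve-∀ ℤ[q]-solver
  reassoc : ∀ q x y z → q *ₚ (x *ₚ (y *ₚ z)) ≋ (q *ₚ (x *ₚ y)) *ₚ z
  reassoc = solve-∀ ℤ[q]-solver
  e₁ : ∀ κ s u w → (κ + (s + w)) + (κ + (s + u)) ≡ (((κ + κ) + s) + w) + (s + u)
  e₁ = ℕ-Solver.solve-∀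
  e₂ : ∀ κ s w → (κ + (s + w)) + κ ≡ ((κ + κ) + s) + w
  e₂ = ℕ-Solver.solve-∀
  e₃ : ∀ κ s w → (κ + κ) + (s + w) ≡ w + ((κ + κ) + s)
  e₃ = ℕ-Solver.solve-∀
  e₄ : ∀ κ s u w → w + ((((κ + κ) + s) + s) + u) ≡ (κ + (s + w)) + (κ + (s + u))
  e₄ = ℕ-Solver.solve-∀
  e₅ : ∀ κ s u → (((κ + κ) + s) + s) + u ≡ (κ + (s + u)) + (κ + s)
  e₅ = ℕ-Solver.solve-∀
  e₆ : ∀ κ s → ((κ + κ) + s) + s ≡ (κ + s) + (κ + s)
  e₆ = ℕ-Solver.solve-∀
  e₇ : ∀ κ s → (κ + κ) + s ≡ (κ + s) + κ
  e₇ = ℕ-Solver.solve-∀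

pair-vanishing : ∀ ε n b κ → edge n b (+ κ) *ₚ edge b n (+ κ) ≋ [] →
  (∀ r → r < suc (b ⊓ n) → edge r r (+ κ) ≋ []) →
  qpow (extra ε κ) *ₚ (edge n b (+ κ) *ₚ edge b n (+ κ)) ≋ ∑[ r < suc (b ⊓ n) ] pairWeight ε n b r *ₚ edge r r (+ κ)
pair-vanishing ε n b κ lhs rhs = ≋-trans (*ₚ-absorbʳ (qpow (extra ε κ)) lhs)
  (≋-sym (∑-zero (suc (b ⊓ n)) λ r r< → *ₚ-absorbʳ (pairWeight ε n b r) (rhs r r<)))

pair-reduction⁺ : ∀ ε n b κ →
  qpow (extra ε κ) *ₚ (edge n b (+ κ) *ₚ edge b n (+ κ)) ≋ ∑[ r < suc (b ⊓ n) ] pairWeight ε n b r *ₚ edge r r (+ κ)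
pair-reduction⁺ ε n b κ with κ ℕ.≤? b | κ ℕ.≤? n
... | no κ≰b | _ = pair-vanishing ε n b κ (*ₚ-absorbˡ _ (edge-> n (ℕP.≰⇒> κ≰b)))
  (λ r r≤b⊓n → edge-> r (ℕP.≤-<-trans (ℕP.≤-trans (ℕP.≤-pred r≤b⊓n) (ℕP.m⊓n≤m b n)) (ℕP.≰⇒> κ≰b)))
... | yes _ | no κ≰n = pair-vanishing ε n b κ (*ₚ-absorbʳ (edge n b (+ κ)) (edge-> b (ℕP.≰⇒> κ≰n)))
  (λ r r≤b⊓n → edge-> r (ℕP.≤-<-trans (ℕP.≤-trans (ℕP.≤-pred r≤b⊓n) (ℕP.m⊓n≤n b n)) (ℕP.≰⇒> κ≰n)))
... | yes κ≤b | yes κ≤n with ℕP.m≤n⇒∃[o]m+o≡n κ≤b | ℕP.m≤n⇒∃[o]m+o≡n κ≤n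
... | β , refl | γ , refl = begin
  E *ₚ (L *ₚ M)
    ≈⟨ commute E L M ⟩
  L *ₚ (E *ₚ M)
    ≈⟨ *ₚ-congˡ L (≋-trans (*ₚ-congˡ E (edge-shifted κ β γ)) (middle-expansion ε κ β γ)) ⟩
  L *ₚ ∑ (suc (β ⊓ γ)) (middle-term ε κ β γ)
    ≈⟨ ∑-*ₚˡ (suc (β ⊓ γ)) L (middle-term ε κ β γ) ⟩
  ∑[ s < suc (β ⊓ γ) ] L *ₚ middle-term ε κ β γ s
    ≈⟨ ∑-cong (suc (β ⊓ γ)) term ⟩
  ∑[ s < suc (β ⊓ γ) ] T (κ + s)
    ≈⟨ ≋-sym (∑-offset κ (suc (β ⊓ γ)) T λ r r<κ → *ₚ-absorbʳ (pairWeight ε (κ + γ) (κ + β) r) (edge-> r r<κ)) ⟩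
  ∑ (κ + suc (β ⊓ γ)) T
    ≡⟨ cong (λ x → ∑ x T) (trans (ℕP.+-suc κ (β ⊓ γ)) (cong suc (ℕP.+-distribˡ-⊓ κ β γ))) ⟩
  ∑ (suc ((κ + β) ⊓ (κ + γ))) T ∎
  where
  E = qpow (extra ε κ)
  L = edge (κ + γ) (κ + β) (+ κ)
  M = edge (κ + β) (κ + γ) (+ κ)
  T : ℕ → Poly
  T r = pairWeight ε (κ + γ) (κ + β) r *ₚ edge r r (+ κ)
  commute : ∀ e l m → e *ₚ (l *ₚ m) ≋ l *ₚ (e *ₚ m)
  commute = solve-∀ ℤ[q]-solver
  term : ∀ s → s < suc (β ⊓ γ) → L *ₚ middle-term ε κ β γ s ≋ T (κ + s)
  term s (s≤s s≤β⊓γ) with ℕP.m≤n⇒∃[o]m+o≡n (ℕP.≤-trans s≤β⊓γ (ℕP.m⊓n≤m β γ))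
                        | ℕP.m≤n⇒∃[o]m+o≡n (ℕP.≤-trans s≤β⊓γ (ℕP.m⊓n≤n β γ))
  ... | u , refl | w , refl = pair-reduction-term ε κ s u w

pair-reduction : ∀ ε n b k →
  qpow (extra ε ℤ.∣ k ∣) *ₚ (edge n b k *ₚ edge b n k) ≋ ∑[ r < suc (b ⊓ n) ] pairWeight ε n b r *ₚ edge r r k
pair-reduction ε n b (+ κ)    = pair-reduction⁺ ε n b κ
pair-reduction ε n b -[1+ κ ] = begin
  E *ₚ (edge n b k *ₚ edge b n k)
    ≈⟨ *ₚ-congˡ E (≋-trans (*ₚ-cong (edge-mirror n b κ) (edge-mirror b n κ)) (*ₚ-comm (edge b n K) (edge n b K))) ⟩
  E *ₚ (edge n b K *ₚ edge b n K)
    ≈⟨ pair-reduction⁺ ε n b (suc κ) ⟩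
  ∑[ r < suc (b ⊓ n) ] pairWeight ε n b r *ₚ edge r r K
    ≈⟨ ∑-cong (suc (b ⊓ n)) (λ r _ → *ₚ-congˡ (pairWeight ε n b r) (≋-sym (edge-mirror r r κ))) ⟩
  ∑[ r < suc (b ⊓ n) ] pairWeight ε n b r *ₚ edge r r k ∎
  where
  k = -[1+ κ ]
  K = + suc κ
  E = qpow (extra ε (suc κ))

C2-suc : ∀ n → suc n C 2 ≡ n C 2 + n
C2-suc n = trans (sym (nCk+nC[k+1]≡[n+1]C[k+1] n 1)) (trans (cong (_+ n C 2) (nC1≡n n)) (ℕP.+-comm n (n C 2)))

alternating-term : ℕ → ℕ → ℕ → Poly
alternating-term N s i = scaleₚ (sign (+ i)) (qpow (i C 2 + s ℕ.* (N ∸ i)) *ₚ qbin N i)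

alternating-term′ : ℕ → ℕ → ℕ → Poly
alternating-term′ N s i = scaleₚ (sign (+ i)) (qpow (i C 2 + i + s ℕ.* (N ∸ i)) *ₚ qbin N i)

scaleₚ-commute : ∀ c p r → p *ₚ scaleₚ c r ≋ scaleₚ c (p *ₚ r)
scaleₚ-commute c p r = ≋-trans (*ₚ-comm p (scaleₚ c r)) (≋-trans (scaleₚ-*ₚ c r p) (scaleₚ-cong c (*ₚ-comm r p)))

pascal-term : ℕ → ℕ → ℕ → Poly
pascal-term N s j = scaleₚ (sign (+ j)) (qpow (j C 2 + s ℕ.* (suc N ∸ j) + j) *ₚ qbin N j)

alternating-term-pascal : ∀ N s i →
  alternating-term (suc N) s (suc i) ≋ negₚ (alternating-term′ N s i) +ₚ pascal-term N s (suc i)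
alternating-term-pascal N s i = begin
  scaleₚ σ (qpow e *ₚ (qbin N i +ₚ qpow (suc i) *ₚ qbin N (suc i)))
    ≈⟨ scaleₚ-cong σ (≋-trans (*ₚ-distribˡ-+ₚ (qpow e) (qbin N i) _)
         (+ₚ-cong (*ₚ-congʳ (qbin N i) (qpow-cong exponent))
                  (≋-trans (≋-sym (*ₚ-assoc (qpow e) (qpow (suc i)) (qbin N (suc i))))
                           (*ₚ-congʳ (qbin N (suc i)) (≋-sym (qpow-+ e (suc i))))))) ⟩
  scaleₚ σ (qpow (i C 2 + i + s ℕ.* (N ∸ i)) *ₚ qbin N i +ₚ qpow (e + suc i) *ₚ qbin N (suc i))
    ≈⟨ scaleₚ-distrib-+ₚ σ (qpow (i C 2 + i + s ℕ.* (N ∸ i)) *ₚ qbin N i) (qpow (e + suc i) *ₚ qbin N (suc i)) ⟩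
  scaleₚ (ℤ.- + 1 ℤ.* sign (+ i)) (qpow (i C 2 + i + s ℕ.* (N ∸ i)) *ₚ qbin N i) +ₚ pascal-term N s (suc i)
    ≈⟨ +ₚ-congʳ (pascal-term N s (suc i)) (≋-sym (scaleₚ-scaleₚ (ℤ.- + 1) (sign (+ i)) _)) ⟩
  negₚ (alternating-term′ N s i) +ₚ pascal-term N s (suc i) ∎
  where
  σ = sign (+ suc i)
  e = suc i C 2 + s ℕ.* (N ∸ i)
  exponent : e ≡ i C 2 + i + s ℕ.* (N ∸ i)
  exponent = cong (_+ s ℕ.* (N ∸ i)) (C2-suc i)

pascal-term≋ : ∀ N s j → j ≤ N → pascal-term N s j ≋ qpow s *ₚ alternating-term′ N s j
pascal-term≋ N s j j≤N = ≋-trans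
  (scaleₚ-cong (sign (+ j)) (≋-trans (*ₚ-congʳ (qbin N j) (≋-trans (qpow-cong exponent) (qpow-+ s _)))
                                     (*ₚ-assoc (qpow s) _ (qbin N j))))
  (≋-sym (scaleₚ-commute (sign (+ j)) (qpow s) _))
  where
  exponent : j C 2 + s ℕ.* (suc N ∸ j) + j ≡ s + (j C 2 + j + s ℕ.* (N ∸ j))
  exponent rewrite ℕP.+-∸-assoc 1 j≤N = identity (j C 2) s j (N ∸ j)
    where
    identity : ∀ h s j x → h + s ℕ.* suc x + j ≡ s + (h + j + s ℕ.* x)
    identity = ℕ-Solver.solve-∀

-- Pascal's rule in the top index splits the alternating sum for N + 1
-- into a q^s-shifted and an unshifted copy of a sum for N.
alternating-suc : ∀ N s →
  ∑ (suc (suc N)) (alternating-term (suc N) s)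
    ≋ qpow s *ₚ ∑ (suc N) (alternating-term′ N s) +ₚ negₚ (∑ (suc N) (alternating-term′ N s))
alternating-suc N s = begin
  ∑ (suc (suc N)) (alternating-term (suc N) s)
    ≈⟨ ∑-suc (suc N) (alternating-term (suc N) s) ⟩
  alternating-term (suc N) s 0 +ₚ (∑[ i < suc N ] alternating-term (suc N) s (suc i))
    ≈⟨ +ₚ-cong first (≋-trans (∑-cong (suc N) λ i _ → alternating-term-pascal N s i) (∑-+ₚ (suc N) (negₚ ∘ Y) (α ∘ suc))) ⟩
  α 0 +ₚ (∑ (suc N) (negₚ ∘ Y) +ₚ ∑ (suc N) (α ∘ suc))
    ≈⟨ rearrange (α 0) (∑ (suc N) (negₚ ∘ Y)) (∑ (suc N) (α ∘ suc)) ⟩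
  (α 0 +ₚ ∑ (suc N) (α ∘ suc)) +ₚ ∑ (suc N) (negₚ ∘ Y)
    ≈⟨ +ₚ-cong (≋-sym (∑-suc (suc N) α)) (≋-sym (∑-scaleₚ (suc N) (ℤ.- + 1) Y)) ⟩
  ∑ (suc (suc N)) α +ₚ negₚ (∑ (suc N) Y)
    ≈⟨ +ₚ-congʳ _ (≋-trans (+ₚ-congˡ (∑ (suc N) α) last) (+ₚ-identityʳ _)) ⟩
  ∑ (suc N) α +ₚ negₚ (∑ (suc N) Y)
    ≈⟨ +ₚ-congʳ _ (≋-trans (∑-cong (suc N) λ j j<N+1 → pascal-term≋ N s j (ℕP.≤-pred j<N+1))
                           (≋-sym (∑-*ₚˡ (suc N) (qpow s) Y))) ⟩
  qpow s *ₚ ∑ (suc N) Y +ₚ negₚ (∑ (suc N) Y) ∎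
  where
  Y = alternating-term′ N s
  α = pascal-term N s
  rearrange : ∀ a b c → a +ₚ (b +ₚ c) ≋ (a +ₚ c) +ₚ b
  rearrange = solve-∀ ℤ[q]-solver
  first : alternating-term (suc N) s 0 ≋ α 0
  first = scaleₚ-cong (+ 1) (*ₚ-congʳ oneₚ (qpow-cong (sym (ℕP.+-identityʳ (s ℕ.* suc N)))))
  last : α (suc N) ≋ []
  last = scaleₚ-cong (sign (+ suc N)) (*ₚ-absorbʳ (qpow (suc N C 2 + s ℕ.* (suc N ∸ suc N) + suc N)) (qbin-> {N} ℕP.≤-refl))

alternating′-suc : ∀ N s → ∑ (suc N) (alternating-term′ N (suc s)) ≋ qpow N *ₚ ∑ (suc N) (alternating-term N s)
alternating′-suc N s = ≋-trans (∑-cong (suc N) shift) (≋-sym (∑-*ₚˡ (suc N) (qpow N) (alternating-term N s)))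
  where
  shift : ∀ i → i < suc N → alternating-term′ N (suc s) i ≋ qpow N *ₚ alternating-term N s i
  shift i (s≤s i≤N) = ≋-trans
    (scaleₚ-cong (sign (+ i)) (≋-trans (*ₚ-congʳ (qbin N i) (≋-trans (qpow-cong exponent) (qpow-+ N _)))
                                       (*ₚ-assoc (qpow N) _ (qbin N i))))
    (≋-sym (scaleₚ-commute (sign (+ i)) (qpow N) _))
    where
    exponent : i C 2 + i + suc s ℕ.* (N ∸ i) ≡ N + (i C 2 + s ℕ.* (N ∸ i))
    exponent with ℕP.m≤n⇒∃[o]m+o≡n i≤N
    ... | v , refl rewrite ℕP.m+n∸m≡n i v = identity (i C 2) i s v
      where
      identity : ∀ h i s v → h + i + suc s ℕ.* v ≡ (i + v) + (h + s ℕ.* v)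
      identity = ℕ-Solver.solve-∀

-- The sum equals (q^s - 1)(q^s - q) ⋯ (q^s - q^(N-1)) (q-binomial theorem), hence vanishes for s < N.
alternating-vanishes : ∀ {s N} → s < N → ∑ (suc N) (alternating-term N s) ≋ []
alternating-vanishes {zero}  {suc N} _ = ≋-trans (alternating-suc N 0)
  (≋-trans (+ₚ-congʳ (negₚ Y) (*ₚ-identityˡ Y)) (+ₚ-inverseʳ Y))
  where
  Y = ∑ (suc N) (alternating-term′ N 0)
alternating-vanishes {suc s} {suc N} (s≤s s<N) = ≋-trans (alternating-suc N (suc s))
  (≋-trans (+ₚ-cong (*ₚ-congˡ (qpow (suc s)) vanish) (scaleₚ-cong (ℤ.- + 1) vanish))
           (+ₚ-cong (*ₚ-zeroʳ (qpow (suc s))) ≋-refl))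
  where
  vanish : ∑ (suc N) (alternating-term′ N (suc s)) ≋ []
  vanish = ≋-trans (alternating′-suc N s) (*ₚ-absorbʳ (qpow N) (alternating-vanishes s<N))

∑± : ℕ → (ℤ → Poly) → Poly
∑± n f = ∑[ t < suc (2 ℕ.* n) ] f (+ t ℤ.- + n)

Ssum≋∑± : ∀ n₁ rest j → Ssum n₁ rest j ≋ ∑± n₁ (summand n₁ rest j)
Ssum≋∑± n₁ rest j = sumₚ-applyUpTo (suc (2 ℕ.* n₁)) (λ t → summand n₁ rest j (+ t ℤ.- + n₁)) id

∑±-cong : ∀ n {f g} → (∀ k → f k ≋ g k) → ∑± n f ≋ ∑± n g
∑±-cong n e = ∑-cong (suc (2 ℕ.* n)) λ t _ → e (+ t ℤ.- + n)

∑±-∑ : ∀ n m (c : ℕ → Poly) (f : ℕ → ℤ → Poly) →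
  ∑± n (λ k → ∑[ r < m ] c r *ₚ f r k) ≋ ∑[ r < m ] c r *ₚ ∑± n (f r)
∑±-∑ n m c f = ≋-trans (∑-comm (suc (2 ℕ.* n)) m λ t r → c r *ₚ f r (+ t ℤ.- + n))
  (∑-cong m λ r _ → ≋-sym (∑-*ₚˡ (suc (2 ℕ.* n)) (c r) λ t → f r (+ t ℤ.- + n)))

∑±-suc : ∀ n f → ∑± (suc n) f ≋ f -[1+ n ] +ₚ ∑± n f +ₚ f (+ suc n)
∑±-suc n f = begin
  ∑ (suc (2 ℕ.* suc n)) g               ≡⟨ cong (λ x → ∑ (suc x) g) (double-suc n) ⟩
  ∑ (suc (suc (2 ℕ.* n))) g +ₚ g (suc (suc (2 ℕ.* n)))
    ≈⟨ +ₚ-cong (∑-suc (suc (2 ℕ.* n)) g) (≡⇒≋ (cong f top)) ⟩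
  g 0 +ₚ ∑ (suc (2 ℕ.* n)) (g ∘ suc) +ₚ f (+ suc n)
    ≈⟨ +ₚ-congʳ (f (+ suc n)) (+ₚ-congˡ (g 0) (∑-cong (suc (2 ℕ.* n)) λ t _ → ≡⇒≋ (cong f (shift t)))) ⟩
  f -[1+ n ] +ₚ ∑± n f +ₚ f (+ suc n) ∎
  where
  g : ℕ → Poly
  g t = f (+ t ℤ.- + suc n)
  double-suc : ∀ n → 2 ℕ.* suc n ≡ suc (suc (2 ℕ.* n))
  double-suc = ℕ-Solver.solve-∀
  shift : ∀ t → + suc t ℤ.- + suc n ≡ + t ℤ.- + n
  shift t = trans (ℤP.m-n≡m⊖n (suc t) (suc n)) (trans (ℤP.[1+m]⊖[1+n]≡m⊖n t n) (sym (ℤP.m-n≡m⊖n t n)))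
  top : + suc (suc (2 ℕ.* n)) ℤ.- + suc n ≡ + suc n
  top = trans (cong (λ x → + x ℤ.- + suc n) (identity n)) (trans (ℤP.m-n≡m⊖n (suc n + suc n) (suc n))
          (trans (ℤP.⊖-≥ (ℕP.m≤n+m (suc n) (suc n))) (cong +_ (ℕP.m+n∸n≡m (suc n) (suc n)))))
    where
    identity : ∀ n → suc (suc (2 ℕ.* n)) ≡ suc n + suc n
    identity = ℕ-Solver.solve-∀

∑±-trim : ∀ {r n} f → r ≤ n → (∀ κ → r < κ → f (+ κ) ≋ []) → (∀ κ → r ≤ κ → f -[1+ κ ] ≋ []) →
  ∑± n f ≋ ∑± r f
∑±-trim {r} f r≤n pos neg with ℕP.m≤n⇒∃[o]m+o≡n r≤n
... | d , refl = go d
  where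
  go : ∀ d → ∑± (r + d) f ≋ ∑± r f
  go zero    = ≡⇒≋ (cong (λ x → ∑± x f) (ℕP.+-identityʳ r))
  go (suc d) = begin
    ∑± (r + suc d) f                                         ≡⟨ cong (λ x → ∑± x f) (ℕP.+-suc r d) ⟩
    ∑± (suc (r + d)) f                                       ≈⟨ ∑±-suc (r + d) f ⟩
    f -[1+ r + d ] +ₚ ∑± (r + d) f +ₚ f (+ suc (r + d))
      ≈⟨ +ₚ-cong (+ₚ-cong (neg (r + d) (ℕP.m≤m+n r d)) (go d)) (pos (suc (r + d)) (s≤s (ℕP.m≤m+n r d))) ⟩
    ∑± r f +ₚ []                                             ≈⟨ +ₚ-identityʳ _ ⟩
    ∑± r f                                                   ∎

C2-+ : ∀ m n → (m + n) C 2 ≡ m C 2 + n C 2 + m ℕ.* n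
C2-+ zero    n = sym (ℕP.+-identityʳ (n C 2))
C2-+ (suc m) n = trans (C2-suc (m + n)) (trans (cong (_+ (m + n)) (C2-+ m n))
  (trans (identity (m C 2) (n C 2) m n) (cong (λ x → x + n C 2 + suc m ℕ.* n) (sym (C2-suc m)))))
  where
  identity : ∀ x y m n → x + y + m ℕ.* n + (m + n) ≡ x + m + y + suc m ℕ.* n
  identity = ℕ-Solver.solve-∀

C2-double : ∀ n → 2 ℕ.* (n C 2) + n ≡ n ℕ.* n
C2-double zero    = refl
C2-double (suc n) = trans (cong (λ x → 2 ℕ.* x + suc n) (C2-suc n))
  (trans (identity (n C 2) n) (trans (cong (λ x → x + 2 ℕ.* n + 1) (C2-double n)) (identity′ n)))
  where
  identity : ∀ x n → 2 ℕ.* (x + n) + suc n ≡ (2 ℕ.* x + n) + 2 ℕ.* n + 1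
  identity = ℕ-Solver.solve-∀
  identity′ : ∀ n → n ℕ.* n + 2 ℕ.* n + 1 ≡ suc n ℕ.* suc n
  identity′ = ℕ-Solver.solve-∀

loop-exponent⁺ : ∀ u v → (u + v) ℕ.* (u + v) + (u + v) C 2 + u C 2 ≡ ((u + v) + u) C 2 + (u + v) ℕ.* v
loop-exponent⁺ u v = trans (identity u v ((u + v) C 2) (u C 2))
  (cong (_+ (u + v) ℕ.* v) (sym (C2-+ (u + v) u)))
  where
  identity : ∀ u v x y → (u + v) ℕ.* (u + v) + x + y ≡ x + y + (u + v) ℕ.* u + (u + v) ℕ.* v
  identity = ℕ-Solver.solve-∀

loop-exponent⁻ : ∀ t w → let r = t + suc w in r ℕ.* r + r C 2 + suc (suc w) C 2 ≡ t C 2 + r ℕ.* (r + suc w)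
loop-exponent⁻ t w =
  trans (cong₂ (λ x y → r ℕ.* r + x + y) (C2-+ t W) (C2-suc W))
  (trans (identity t W (t C 2) (W C 2))
  (trans (cong (λ x → r ℕ.* r + t C 2 + t ℕ.* W + x) (C2-double W))
         (identity′ t W (t C 2))))
  where
  W = suc w
  r = t + W
  identity : ∀ t W x y → (t + W) ℕ.* (t + W) + (x + y + t ℕ.* W) + (y + W) ≡ (t + W) ℕ.* (t + W) + x + t ℕ.* W + (2 ℕ.* y + W)
  identity = ℕ-Solver.solve-∀
  identity′ : ∀ t W x → (t + W) ℕ.* (t + W) + x + t ℕ.* W + W ℕ.* W ≡ x + (t + W) ℕ.* ((t + W) + W)
  identity′ = ℕ-Solver.solve-∀

sign-cancel : ∀ a b → sign (+ a) ℤ.* sign (+ (a + b)) ≡ sign (+ b)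
sign-cancel a b = trans (cong (sign (+ a) ℤ.*_) (ℤP.^-distribˡ-+-* (ℤ.- + 1) a b))
  (trans (sym (ℤP.*-assoc (sign (+ a)) (sign (+ a)) (sign (+ b))))
  (trans (cong (ℤ._* sign (+ b)) (square a)) (ℤP.*-identityˡ (sign (+ b)))))
  where
  square : ∀ a → sign (+ a) ℤ.* sign (+ a) ≡ + 1
  square zero    = refl
  square (suc a) = trans (identity (sign (+ a))) (square a)
    where
    identity : ∀ x → (ℤ.- + 1 ℤ.* x) ℤ.* (ℤ.- + 1 ℤ.* x) ≡ x ℤ.* x
    identity = ℤ-Solver.solve-∀

qpow-*ₚ-cancel : ∀ c {p} → qpow c *ₚ p ≋ [] → p ≋ []
qpow-*ₚ-cancel zero    {p} e = ≋-trans (≋-sym (*ₚ-identityˡ p)) e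
qpow-*ₚ-cancel (suc c) {p} e = qpow-*ₚ-cancel c (mk≋ λ d → coeff-≡ (≋-trans (≋-sym (*ₚ-shiftˡ (qpow c) p)) e) (suc d))

2*n≡n+n : ∀ n → 2 ℕ.* n ≡ n + n
2*n≡n+n n = cong (λ x → n + x) (ℕP.+-identityʳ n)

rescale : ∀ c ρ σ′ {a e σ B B′} → c + a ≡ e → σ ≡ ρ ℤ.* σ′ → B ≋ B′ →
  qpow c *ₚ scaleₚ σ (qpow a *ₚ B) ≋ scaleₚ ρ (scaleₚ σ′ (qpow e *ₚ B′))
rescale c ρ σ′ {a} {e} {σ} {B} {B′} refl refl B≋B′ = begin
  qpow c *ₚ scaleₚ σ (qpow a *ₚ B)    ≈⟨ scaleₚ-commute σ (qpow c) (qpow a *ₚ B) ⟩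
  scaleₚ σ (qpow c *ₚ (qpow a *ₚ B))  ≈⟨ scaleₚ-cong σ (≋-trans (≋-sym (*ₚ-assoc (qpow c) (qpow a) B))
                                                               (*ₚ-cong (≋-sym (qpow-+ c a)) B≋B′)) ⟩
  scaleₚ σ (qpow (c + a) *ₚ B′)       ≈⟨ ≋-sym (scaleₚ-scaleₚ ρ σ′ _) ⟩
  scaleₚ ρ (scaleₚ σ′ (qpow e *ₚ B′)) ∎

m+n-m≡n : ∀ m n → + (m + n) ℤ.- + m ≡ + n
m+n-m≡n m n = trans (ℤP.m-n≡m⊖n (m + n) m) (trans (ℤP.⊖-≥ (ℕP.m≤m+n m n)) (cong +_ (ℕP.m+n∸m≡n m n)))

loop-term⁺ : ∀ u v → let r = u + v in
  qpow (r ℕ.* r + r C 2) *ₚ summand r [] 0 (+ (r + u) ℤ.- + r) ≋ scaleₚ (sign (+ r)) (alternating-term (2 ℕ.* r) r (r + u))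
loop-term⁺ u v = begin
  qpow (r ℕ.* r + r C 2) *ₚ summand r [] 0 (+ (r + u) ℤ.- + r)
    ≡⟨ cong (λ k → qpow (r ℕ.* r + r C 2) *ₚ summand r [] 0 k) (m+n-m≡n r u) ⟩
  qpow (r ℕ.* r + r C 2) *ₚ scaleₚ (sign (+ u)) (qpow (u C 2) *ₚ (qbin (r + r) (r + u) *ₚ oneₚ))
    ≈⟨ rescale (r ℕ.* r + r C 2) (sign (+ r)) (sign (+ (r + u)))
               (trans (loop-exponent⁺ u v) (cong (λ x → (r + u) C 2 + r ℕ.* x) (sym gap)))
               (sym (sign-cancel r u))
               (≋-trans (*ₚ-identityʳ _) (qbin-congₙ (r + u) (sym (2*n≡n+n r)))) ⟩
  scaleₚ (sign (+ r)) (alternating-term (2 ℕ.* r) r (r + u)) ∎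
  where
  r = u + v
  gap : 2 ℕ.* r ∸ (r + u) ≡ v
  gap = trans (cong (_∸ (r + u)) (identity u v)) (ℕP.m+n∸m≡n (r + u) v)
    where
    identity : ∀ u v → 2 ℕ.* (u + v) ≡ ((u + v) + u) + v
    identity = ℕ-Solver.solve-∀

loop-term⁻ : ∀ t w → let r = t + suc w in
  qpow (r ℕ.* r + r C 2) *ₚ summand r [] 0 (+ t ℤ.- + r) ≋ scaleₚ (sign (+ r)) (alternating-term (2 ℕ.* r) r t)
loop-term⁻ t w = begin
  qpow (r ℕ.* r + r C 2) *ₚ summand r [] 0 (+ t ℤ.- + r)
    ≡⟨ cong (λ k → qpow (r ℕ.* r + r C 2) *ₚ summand r [] 0 k) t-r≡ ⟩
  qpow (r ℕ.* r + r C 2) *ₚ scaleₚ (sign (+ suc w)) (qpow (suc (suc w) C 2) *ₚ (qbinℤ (r + r) (+ r ℤ.+ -[1+ w ]) *ₚ oneₚ))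
    ≈⟨ rescale (r ℕ.* r + r C 2) (sign (+ r)) (sign (+ t))
               (trans (loop-exponent⁻ t w) (cong (λ x → t C 2 + r ℕ.* x) (sym gap)))
               (sym (trans (ℤP.*-comm (sign (+ r)) (sign (+ t))) (sign-cancel t (suc w))))
               (≋-trans (*ₚ-identityʳ _) (≋-trans (≡⇒≋ (cong (qbinℤ (r + r)) r-[1+w]≡))
                                                  (qbin-congₙ t (sym (2*n≡n+n r))))) ⟩
  scaleₚ (sign (+ r)) (alternating-term (2 ℕ.* r) r t) ∎
  where
  r = t + suc w
  t-r≡ : + t ℤ.- + r ≡ -[1+ w ]
  t-r≡ = trans (ℤP.m-n≡m⊖n t r) (trans (ℤP.⊖-< (ℕP.m<m+n t (s≤s z≤n))) (cong (λ x → ℤ.- + x) (ℕP.m+n∸m≡n t (suc w))))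
  r-[1+w]≡ : + r ℤ.+ -[1+ w ] ≡ + t
  r-[1+w]≡ = trans (ℤP.⊖-≥ (ℕP.m≤n+m (suc w) t)) (cong +_ (ℕP.m+n∸n≡m t (suc w)))
  gap : 2 ℕ.* r ∸ t ≡ r + suc w
  gap = trans (cong (_∸ t) (identity t w)) (ℕP.m+n∸m≡n t (r + suc w))
    where
    identity : ∀ t w → 2 ℕ.* (t + suc w) ≡ t + ((t + suc w) + suc w)
    identity = ℕ-Solver.solve-∀

loop-term : ∀ r t → t ≤ 2 ℕ.* r →
  qpow (r ℕ.* r + r C 2) *ₚ summand r [] 0 (+ t ℤ.- + r) ≋ scaleₚ (sign (+ r)) (alternating-term (2 ℕ.* r) r t)
loop-term r t t≤2r with r ℕ.≤? t
... | yes r≤t with ℕP.m≤n⇒∃[o]m+o≡n r≤t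
...   | u , refl with ℕP.m≤n⇒∃[o]m+o≡n (ℕP.+-cancelˡ-≤ r u r (subst (r + u ≤_) (2*n≡n+n r) t≤2r))
...     | v , refl = loop-term⁺ u v
loop-term r t t≤2r | no r≰t with ℕP.m≤n⇒∃[o]m+o≡n (ℕP.≰⇒> r≰t)
... | w , e with trans (ℕP.+-suc t w) e
...   | refl = loop-term⁻ t w

loop-sum-vanishes : ∀ r → 0 < r → ∑± r (summand r [] 0) ≋ []
loop-sum-vanishes r 0<r = qpow-*ₚ-cancel (r ℕ.* r + r C 2) (begin
  qpow c *ₚ ∑± r (summand r [] 0)
    ≈⟨ ∑-*ₚˡ (suc (2 ℕ.* r)) (qpow c) _ ⟩
  ∑[ t < suc (2 ℕ.* r) ] qpow c *ₚ summand r [] 0 (+ t ℤ.- + r)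
    ≈⟨ ∑-cong (suc (2 ℕ.* r)) (λ t t<2r+1 → loop-term r t (ℕP.≤-pred t<2r+1)) ⟩
  ∑[ t < suc (2 ℕ.* r) ] scaleₚ (sign (+ r)) (alternating-term (2 ℕ.* r) r t)
    ≈⟨ ≋-sym (∑-scaleₚ (suc (2 ℕ.* r)) (sign (+ r)) (alternating-term (2 ℕ.* r) r)) ⟩
  scaleₚ (sign (+ r)) (∑ (suc (2 ℕ.* r)) (alternating-term (2 ℕ.* r) r))
    ≈⟨ scaleₚ-cong (sign (+ r)) (alternating-vanishes {r} {2 ℕ.* r} (subst (r <_) (sym (2*n≡n+n r)) (ℕP.m<m+n r 0<r))) ⟩
  [] ∎)
  where
  c = r ℕ.* r + r C 2

Nonnegative : Poly → Set
Nonnegative p = ∀ d → 0ℤ ℤ.≤ coeff p d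

0≤* : ∀ {x y} → 0ℤ ℤ.≤ x → 0ℤ ℤ.≤ y → 0ℤ ℤ.≤ x ℤ.* y
0≤* {+ m} {+ n} _ _ = subst (0ℤ ℤ.≤_) (ℤP.pos-* m n) (ℤ.+≤+ z≤n)

nonneg-[] : Nonnegative []
nonneg-[] _ = ℤ.+≤+ z≤n

nonneg-+ₚ : ∀ p r → Nonnegative p → Nonnegative r → Nonnegative (p +ₚ r)
nonneg-+ₚ p r p≥0 r≥0 d = subst (0ℤ ℤ.≤_) (sym (coeff-+ₚ p r d)) (ℤP.+-mono-≤ (p≥0 d) (r≥0 d))

nonneg-*ₚ : ∀ p r → Nonnegative p → Nonnegative r → Nonnegative (p *ₚ r)
nonneg-*ₚ p r p≥0 r≥0 d = subst (0ℤ ℤ.≤_) (sym (coeff-*ₚ p r d)) (convolution-nonneg (coeff p) p≥0 d)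
  where
  convolution-nonneg : ∀ f → (∀ i → 0ℤ ℤ.≤ f i) → ∀ d → 0ℤ ℤ.≤ convolution f (coeff r) d
  convolution-nonneg f f≥0 zero    = 0≤* (f≥0 0) (r≥0 0)
  convolution-nonneg f f≥0 (suc d) = ℤP.+-mono-≤ (0≤* (f≥0 0) (r≥0 (suc d))) (convolution-nonneg (f ∘ suc) (f≥0 ∘ suc) d)

nonneg-qpow : ∀ e → Nonnegative (qpow e)
nonneg-qpow zero    zero    = ℤ.+≤+ z≤n
nonneg-qpow zero    (suc d) = ℤ.+≤+ z≤n
nonneg-qpow (suc e) zero    = ℤ.+≤+ z≤n
nonneg-qpow (suc e) (suc d) = nonneg-qpow e d

nonneg-qbin : ∀ n k → Nonnegative (qbin n k)
nonneg-qbin n       zero    = nonneg-qpow 0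
nonneg-qbin zero    (suc k) = nonneg-[]
nonneg-qbin (suc n) (suc k) = nonneg-+ₚ (qbin n k) _ (nonneg-qbin n k)
  (nonneg-*ₚ (qpow (suc k)) (qbin n (suc k)) (nonneg-qpow (suc k)) (nonneg-qbin n (suc k)))

nonneg⇒natural : ∀ p → Nonnegative p → map +_ (map ℤ.∣_∣ p) ≋ p
nonneg⇒natural p p≥0 = mk≋ (go p p≥0)
  where
  go : ∀ p → Nonnegative p → ∀ d → coeff (map +_ (map ℤ.∣_∣ p)) d ≡ coeff p d
  go []      _   d       = refl
  go (a ∷ p) p≥0 zero    = ℤP.0≤i⇒+∣i∣≡i (p≥0 0)
  go (a ∷ p) p≥0 (suc d) = go p (p≥0 ∘ suc) d

infix 4 _∣⁺_
_∣⁺_ : Poly → Poly → Set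
D ∣⁺ p = ∃ λ P → Nonnegative P × P *ₚ D ≋ p

∣⁺-cong : ∀ {D p p′} → p ≋ p′ → D ∣⁺ p → D ∣⁺ p′
∣⁺-cong p≋p′ (P , P≥0 , eq) = P , P≥0 , ≋-trans eq p≋p′

∣⁺-∑ : ∀ {D} n f → (∀ r → r < n → D ∣⁺ f r) → D ∣⁺ ∑ n f
∣⁺-∑ {D} zero    f div = [] , nonneg-[] , ≋-refl
∣⁺-∑ {D} (suc n) f div with ∣⁺-∑ n f (λ r r<n → div r (ℕP.m<n⇒m<1+n r<n)) | div n ℕP.≤-refl
... | P , P≥0 , eq | R , R≥0 , eq′ =
  P +ₚ R , nonneg-+ₚ P R P≥0 R≥0 , ≋-trans (*ₚ-distribʳ-+ₚ D P R) (+ₚ-cong eq eq′)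

∣⁺-*ₚ : ∀ {D p} c → Nonnegative c → D ∣⁺ p → D ∣⁺ c *ₚ p
∣⁺-*ₚ {D} c c≥0 (P , P≥0 , eq) = c *ₚ P , nonneg-*ₚ c P c≥0 P≥0 , ≋-trans (*ₚ-assoc c P D) (*ₚ-congˡ c eq)

∣⁺-transfer : ∀ {D D′ p} x y → Nonnegative x → y *ₚ D ≋ x *ₚ D′ → D ∣⁺ p → D′ ∣⁺ y *ₚ p
∣⁺-transfer {D} {D′} {p} x y x≥0 yD≋xD′ (P , P≥0 , eq) = x *ₚ P , nonneg-*ₚ x P x≥0 P≥0 , (begin
  (x *ₚ P) *ₚ D′   ≈⟨ regroup x P D′ ⟩
  P *ₚ (x *ₚ D′)   ≈⟨ *ₚ-congˡ P (≋-sym yD≋xD′) ⟩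
  P *ₚ (y *ₚ D)    ≈⟨ regroup′ P y D ⟩
  y *ₚ (P *ₚ D)    ≈⟨ *ₚ-congˡ y eq ⟩
  y *ₚ p           ∎)
  where
  regroup : ∀ x P D → (x *ₚ P) *ₚ D ≋ P *ₚ (x *ₚ D)
  regroup = solve-∀ ℤ[q]-solver
  regroup′ : ∀ P y D → P *ₚ (y *ₚ D) ≋ y *ₚ (P *ₚ D)
  regroup′ = solve-∀ ℤ[q]-solver

path : ℕ → List ℕ → ℕ → ℤ → Poly
path a []      e k = edge a e k *ₚ oneₚ
path a (b ∷ l) e k = edge a b k *ₚ path b l e k

path-zipWith : ∀ a l e k →
  prodₚ (zipWith (λ x s → qbinℤ s (+ x ℤ.+ k)) (a ∷ l) (zipWith _+_ (a ∷ l) (l ++ e ∷ []))) ≡ path a l e k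
path-zipWith a []      e k = refl
path-zipWith a (b ∷ l) e k = cong (edge a b k *ₚ_) (path-zipWith b l e k)

summand≡ : ∀ n₁ rest j k →
  summand n₁ rest j k ≡ scaleₚ (sign k) (qpow (j ℕ.* ℤ.∣ k ∣ ℕ.* ℤ.∣ k ∣ + choose2 k) *ₚ path n₁ rest n₁ k)
summand≡ n₁ rest j k = cong (λ p → scaleₚ (sign k) (qpow (j ℕ.* ℤ.∣ k ∣ ℕ.* ℤ.∣ k ∣ + choose2 k) *ₚ p))
                            (path-zipWith n₁ rest n₁ k)

next : List ℕ → ℕ → ℕ
next []      e = e
next (d ∷ _) e = d

path-tail : List ℕ → ℕ → ℤ → Poly
path-tail []      e k = oneₚ
path-tail (d ∷ l) e k = path d l e k

path-uncons : ∀ a l e k → path a l e k ≡ edge a (next l e) k *ₚ path-tail l e k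
path-uncons a []      e k = refl
path-uncons a (d ∷ l) e k = refl

bump : Bool → ℕ → ℕ
bump true  j = suc j
bump false j = j

qpow-bump : ∀ ε j κ C → qpow (bump ε j ℕ.* κ ℕ.* κ + C) ≋ qpow (extra ε κ) *ₚ qpow (j ℕ.* κ ℕ.* κ + C)
qpow-bump true  j κ C = ≋-trans (qpow-cong (identity j κ C)) (qpow-+ (κ ℕ.* κ) _)
  where
  identity : ∀ j κ C → suc j ℕ.* κ ℕ.* κ + C ≡ κ ℕ.* κ + (j ℕ.* κ ℕ.* κ + C)
  identity = ℕ-Solver.solve-∀
qpow-bump false j κ C = ≋-sym (*ₚ-identityˡ _)

distribute : ∀ σ E W X T n (c Y : ℕ → Poly) → E *ₚ X ≋ ∑[ r < n ] c r *ₚ Y r →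
  scaleₚ σ ((E *ₚ W) *ₚ (X *ₚ T)) ≋ ∑[ r < n ] c r *ₚ scaleₚ σ (W *ₚ (Y r *ₚ T))
distribute σ E W X T n c Y EX≋ = begin
  scaleₚ σ ((E *ₚ W) *ₚ (X *ₚ T))               ≈⟨ scaleₚ≋const*ₚ σ _ ⟩
  (σ ∷ []) *ₚ ((E *ₚ W) *ₚ (X *ₚ T))            ≈⟨ regroup (σ ∷ []) E W X T ⟩
  ((σ ∷ []) *ₚ (W *ₚ T)) *ₚ (E *ₚ X)            ≈⟨ *ₚ-congˡ ((σ ∷ []) *ₚ (W *ₚ T)) EX≋ ⟩
  ((σ ∷ []) *ₚ (W *ₚ T)) *ₚ (∑[ r < n ] c r *ₚ Y r)
    ≈⟨ ∑-*ₚˡ n ((σ ∷ []) *ₚ (W *ₚ T)) (λ r → c r *ₚ Y r) ⟩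
  ∑[ r < n ] ((σ ∷ []) *ₚ (W *ₚ T)) *ₚ (c r *ₚ Y r)
    ≈⟨ ∑-cong n (λ r _ → ≋-trans (regroup′ (σ ∷ []) W T (c r) (Y r))
                                 (*ₚ-congˡ (c r) (≋-sym (scaleₚ≋const*ₚ σ (W *ₚ (Y r *ₚ T)))))) ⟩
  ∑[ r < n ] c r *ₚ scaleₚ σ (W *ₚ (Y r *ₚ T)) ∎
  where
  regroup : ∀ s e w x t → s *ₚ ((e *ₚ w) *ₚ (x *ₚ t)) ≋ (s *ₚ (w *ₚ t)) *ₚ (e *ₚ x)
  regroup = solve-∀ ℤ[q]-solver
  regroup′ : ∀ s w t c y → (s *ₚ (w *ₚ t)) *ₚ (c *ₚ y) ≋ c *ₚ (s *ₚ (w *ₚ (y *ₚ t)))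
  regroup′ = solve-∀ ℤ[q]-solver

summand-reduction : ∀ ε n₁ b c l j k →
  summand n₁ (b ∷ c ∷ l) (bump ε j) k
    ≋ ∑[ r < suc (b ⊓ c) ] weight ε n₁ b c (next l n₁) r *ₚ summand n₁ (r ∷ l) j k
summand-reduction ε n₁ b c l j k = begin
  summand n₁ (b ∷ c ∷ l) (bump ε j) k
    ≡⟨ trans (summand≡ n₁ (b ∷ c ∷ l) (bump ε j) k)
             (cong (λ p → scaleₚ σ (qpow (bump ε j ℕ.* κ ℕ.* κ + C) *ₚ (edge n₁ b k *ₚ (edge b c k *ₚ p))))
                   (path-uncons c l n₁ k)) ⟩
  scaleₚ σ (qpow (bump ε j ℕ.* κ ℕ.* κ + C) *ₚ (edge n₁ b k *ₚ (edge b c k *ₚ (edge c d k *ₚ T))))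
    ≈⟨ scaleₚ-cong σ (*ₚ-cong (qpow-bump ε j κ C) (regroup (edge n₁ b k) (edge b c k) (edge c d k) T)) ⟩
  scaleₚ σ ((E *ₚ W) *ₚ ((edge n₁ b k *ₚ (edge b c k *ₚ edge c d k)) *ₚ T))
    ≈⟨ distribute σ E W _ T (suc (b ⊓ c)) (weight ε n₁ b c d) (λ r → edge n₁ r k *ₚ edge r d k)
                  (triple-reduction ε n₁ b c d k) ⟩
  ∑[ r < suc (b ⊓ c) ] weight ε n₁ b c d r *ₚ scaleₚ σ (W *ₚ ((edge n₁ r k *ₚ edge r d k) *ₚ T))
    ≈⟨ ∑-cong (suc (b ⊓ c)) (λ r _ → *ₚ-congˡ (weight ε n₁ b c d r) (scaleₚ-cong σ (*ₚ-congˡ W (≋-trans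
         (*ₚ-assoc (edge n₁ r k) (edge r d k) T)
         (≡⇒≋ (cong (edge n₁ r k *ₚ_) (sym (path-uncons r l n₁ k))))))))  ⟩
  ∑[ r < suc (b ⊓ c) ] weight ε n₁ b c d r *ₚ scaleₚ σ (W *ₚ path n₁ (r ∷ l) n₁ k)
    ≈⟨ ∑-cong (suc (b ⊓ c)) (λ r _ → *ₚ-congˡ (weight ε n₁ b c d r) (≡⇒≋ (sym (summand≡ n₁ (r ∷ l) j k)))) ⟩
  ∑[ r < suc (b ⊓ c) ] weight ε n₁ b c d r *ₚ summand n₁ (r ∷ l) j k ∎
  where
  σ = sign k
  κ = ℤ.∣ k ∣
  C = choose2 k
  d = next l n₁
  T = path-tail l n₁ k
  E = qpow (extra ε κ)
  W = qpow (j ℕ.* κ ℕ.* κ + C)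
  regroup : ∀ x y z t → x *ₚ (y *ₚ (z *ₚ t)) ≋ (x *ₚ (y *ₚ z)) *ₚ t
  regroup = solve-∀ ℤ[q]-solver

summand-pair-reduction : ∀ ε n₁ b k →
  summand n₁ (b ∷ []) (bump ε 0) k ≋ ∑[ r < suc (b ⊓ n₁) ] pairWeight ε n₁ b r *ₚ summand r [] 0 k
summand-pair-reduction ε n₁ b k = begin
  summand n₁ (b ∷ []) (bump ε 0) k
    ≡⟨ summand≡ n₁ (b ∷ []) (bump ε 0) k ⟩
  scaleₚ σ (qpow (bump ε 0 ℕ.* κ ℕ.* κ + C) *ₚ (edge n₁ b k *ₚ (edge b n₁ k *ₚ oneₚ)))
    ≈⟨ scaleₚ-cong σ (*ₚ-cong (qpow-bump ε 0 κ C) (≋-sym (*ₚ-assoc (edge n₁ b k) (edge b n₁ k) oneₚ))) ⟩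
  scaleₚ σ ((qpow (extra ε κ) *ₚ qpow C) *ₚ ((edge n₁ b k *ₚ edge b n₁ k) *ₚ oneₚ))
    ≈⟨ distribute σ (qpow (extra ε κ)) (qpow C) _ oneₚ (suc (b ⊓ n₁)) (pairWeight ε n₁ b) (λ r → edge r r k)
                  (pair-reduction ε n₁ b k) ⟩
  ∑[ r < suc (b ⊓ n₁) ] pairWeight ε n₁ b r *ₚ summand r [] 0 k ∎
  where
  σ = sign k
  κ = ℤ.∣ k ∣
  C = choose2 k

loop-trim : ∀ r n → r ≤ n → ∑± n (summand r [] 0) ≋ ∑± r (summand r [] 0)
loop-trim r n r≤n = ∑±-trim (summand r [] 0) r≤n
  (λ κ r<κ → scaleₚ-cong (sign (+ κ)) (*ₚ-absorbʳ (qpow (κ C 2)) (*ₚ-absorbˡ oneₚ (edge-> r r<κ))))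
  (λ κ r≤κ → scaleₚ-cong (sign -[1+ κ ]) (*ₚ-absorbʳ (qpow (suc (suc κ) C 2))
               (*ₚ-absorbˡ oneₚ (≋-trans (edge-mirror r r κ) (edge-> r (s≤s r≤κ))))))

Ssum-reduction : ∀ ε n₁ b c l j →
  Ssum n₁ (b ∷ c ∷ l) (bump ε j) ≋ ∑[ r < suc (b ⊓ c) ] weight ε n₁ b c (next l n₁) r *ₚ Ssum n₁ (r ∷ l) j
Ssum-reduction ε n₁ b c l j = begin
  Ssum n₁ (b ∷ c ∷ l) (bump ε j)
    ≈⟨ Ssum≋∑± n₁ (b ∷ c ∷ l) (bump ε j) ⟩
  ∑± n₁ (summand n₁ (b ∷ c ∷ l) (bump ε j))
    ≈⟨ ∑±-cong n₁ (summand-reduction ε n₁ b c l j) ⟩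
  ∑± n₁ (λ k → ∑[ r < suc (b ⊓ c) ] weight ε n₁ b c (next l n₁) r *ₚ summand n₁ (r ∷ l) j k)
    ≈⟨ ∑±-∑ n₁ (suc (b ⊓ c)) (weight ε n₁ b c (next l n₁)) (λ r → summand n₁ (r ∷ l) j) ⟩
  ∑[ r < suc (b ⊓ c) ] weight ε n₁ b c (next l n₁) r *ₚ ∑± n₁ (summand n₁ (r ∷ l) j)
    ≈⟨ ∑-cong (suc (b ⊓ c)) (λ r _ → *ₚ-congˡ (weight ε n₁ b c (next l n₁) r) (≋-sym (Ssum≋∑± n₁ (r ∷ l) j))) ⟩
  ∑[ r < suc (b ⊓ c) ] weight ε n₁ b c (next l n₁) r *ₚ Ssum n₁ (r ∷ l) j ∎

Ssum-single : ∀ n → Ssum (suc n) [] 0 ≋ []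
Ssum-single n = ≋-trans (Ssum≋∑± (suc n) [] 0) (loop-sum-vanishes (suc n) (s≤s z≤n))

Ssum-pair : ∀ ε n₁ b → Ssum n₁ (b ∷ []) (bump ε 0) ≋ qpow (weightExp ε b n₁ 0) *ₚ qbin (n₁ + b) n₁
Ssum-pair ε n₁ b = begin
  Ssum n₁ (b ∷ []) (bump ε 0)
    ≈⟨ Ssum≋∑± n₁ (b ∷ []) (bump ε 0) ⟩
  ∑± n₁ (summand n₁ (b ∷ []) (bump ε 0))
    ≈⟨ ∑±-cong n₁ (summand-pair-reduction ε n₁ b) ⟩
  ∑± n₁ (λ k → ∑[ r < suc (b ⊓ n₁) ] pairWeight ε n₁ b r *ₚ summand r [] 0 k)
    ≈⟨ ∑±-∑ n₁ (suc (b ⊓ n₁)) (pairWeight ε n₁ b) (λ r → summand r [] 0) ⟩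
  ∑[ r < suc (b ⊓ n₁) ] pairWeight ε n₁ b r *ₚ ∑± n₁ (summand r [] 0)
    ≈⟨ ∑-suc (b ⊓ n₁) _ ⟩
  pairWeight ε n₁ b 0 *ₚ ∑± n₁ (summand 0 [] 0)
    +ₚ (∑[ r < b ⊓ n₁ ] pairWeight ε n₁ b (suc r) *ₚ ∑± n₁ (summand (suc r) [] 0))
    ≈⟨ +ₚ-cong (*ₚ-congˡ (pairWeight ε n₁ b 0) (loop-trim 0 n₁ z≤n))
               (∑-zero (b ⊓ n₁) λ r r<b⊓n₁ → *ₚ-absorbʳ (pairWeight ε n₁ b (suc r))
                  (≋-trans (loop-trim (suc r) n₁ (ℕP.≤-trans r<b⊓n₁ (ℕP.m⊓n≤n b n₁))) (loop-sum-vanishes (suc r) (s≤s z≤n)))) ⟩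
  pairWeight ε n₁ b 0 *ₚ oneₚ +ₚ []
    ≈⟨ ≋-trans (+ₚ-identityʳ _) (≋-trans (*ₚ-identityʳ _) (*ₚ-congˡ (qpow (weightExp ε b n₁ 0)) (*ₚ-identityʳ _))) ⟩
  qpow (weightExp ε b n₁ 0) *ₚ qbin (n₁ + b) n₁ ∎

nonneg-weight : ∀ ε a b c d r → Nonnegative (weight ε a b c d r)
nonneg-weight ε a b c d r = nonneg-*ₚ (qpow (weightExp ε b c r)) _ (nonneg-qpow (weightExp ε b c r))
  (nonneg-*ₚ (qbin (a + b) (b ∸ r)) (qbin (c + d) (c ∸ r)) (nonneg-qbin (a + b) (b ∸ r)) (nonneg-qbin (c + d) (c ∸ r)))

qbin-transfer : ∀ n₁ c r → r ≤ c → qbin (c + n₁) (c ∸ r) *ₚ qbin (n₁ + r) n₁ ≋ qbin c r *ₚ qbin (n₁ + c) n₁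
qbin-transfer n₁ c r r≤c with ℕP.m≤n⇒∃[o]m+o≡n r≤c
... | u , refl = begin
  qbin ((r + u) + n₁) ((r + u) ∸ r) *ₚ qbin₂ n₁ r
    ≈⟨ *ₚ-congʳ (qbin₂ n₁ r) (≋-trans (qbin-cong (reassoc r u n₁) (ℕP.m+n∸m≡n r u)) (qbin₂-comm u (n₁ + r))) ⟩
  qbin₂ (n₁ + r) u *ₚ qbin₂ n₁ r
    ≈⟨ ≋-sym (qbin₂-trinomial n₁ r u) ⟩
  qbin₂ n₁ (r + u) *ₚ qbin₂ r u
    ≈⟨ *ₚ-comm (qbin₂ n₁ (r + u)) (qbin₂ r u) ⟩
  qbin₂ r u *ₚ qbin₂ n₁ (r + u) ∎
  where
  reassoc : ∀ r u n₁ → (r + u) + n₁ ≡ u + (n₁ + r)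
  reassoc = ℕ-Solver.solve-∀

∣⁺-weight-transfer : ∀ ε n₁ b c r {p} → r ≤ c →
  qbin (n₁ + r) n₁ ∣⁺ p → qbin (n₁ + c) n₁ ∣⁺ weight ε n₁ b c n₁ r *ₚ p
∣⁺-weight-transfer ε n₁ b c r {p} r≤c div =
  ∣⁺-cong (regroup (qpow (weightExp ε b c r)) (qbin (n₁ + b) (b ∸ r)) (qbin (c + n₁) (c ∸ r)) p)
    (∣⁺-*ₚ (qpow (weightExp ε b c r) *ₚ qbin (n₁ + b) (b ∸ r))
           (nonneg-*ₚ (qpow (weightExp ε b c r)) (qbin (n₁ + b) (b ∸ r)) (nonneg-qpow (weightExp ε b c r)) (nonneg-qbin (n₁ + b) (b ∸ r)))
           (∣⁺-transfer (qbin c r) (qbin (c + n₁) (c ∸ r)) (nonneg-qbin c r) (qbin-transfer n₁ c r r≤c) div))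
  where
  regroup : ∀ q x y s → (q *ₚ x) *ₚ (y *ₚ s) ≋ (q *ₚ (x *ₚ y)) *ₚ s
  regroup = solve-∀ ℤ[q]-solver

divisible-reduction : ∀ ε n₁ b c l j {D} →
  (∀ r → r ≤ b ⊓ c → D ∣⁺ weight ε n₁ b c (next l n₁) r *ₚ Ssum n₁ (r ∷ l) j) →
  D ∣⁺ Ssum n₁ (b ∷ c ∷ l) (bump ε j)
divisible-reduction ε n₁ b c l j terms =
  ∣⁺-cong (≋-sym (Ssum-reduction ε n₁ b c l j)) (∣⁺-∑ (suc (b ⊓ c)) _ λ r r<1+b⊓c → terms r (ℕP.≤-pred r<1+b⊓c))

divisible-pair : ∀ ε n₁ b → qbin (n₁ + b) n₁ ∣⁺ Ssum n₁ (b ∷ []) (bump ε 0)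
divisible-pair ε n₁ b = qpow (weightExp ε b n₁ 0) , nonneg-qpow (weightExp ε b n₁ 0) , ≋-sym (Ssum-pair ε n₁ b)

∣⁺-weight : ∀ ε a b c d r {D p} → D ∣⁺ p → D ∣⁺ weight ε a b c d r *ₚ p
∣⁺-weight ε a b c d r = ∣⁺-*ₚ (weight ε a b c d r) (nonneg-weight ε a b c d r)

Ssum-divisible : ∀ n₁ b l j → j ≤ suc (length l) → qbin (n₁ + lastOf b l) n₁ ∣⁺ Ssum n₁ (b ∷ l) j
Ssum-divisible n₁ b []             zero          _         = divisible-pair false n₁ b
Ssum-divisible n₁ b []             (suc zero)    _         = divisible-pair true n₁ b
Ssum-divisible n₁ b []             (suc (suc j)) (s≤s ())
Ssum-divisible n₁ b (c ∷ [])       zero          _         = divisible-reduction false n₁ b c [] 0 λ r r≤b⊓c →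
  ∣⁺-weight-transfer false n₁ b c r (ℕP.≤-trans r≤b⊓c (ℕP.m⊓n≤n b c)) (Ssum-divisible n₁ r [] 0 z≤n)
Ssum-divisible n₁ b (c ∷ [])       (suc j)       (s≤s j≤1) = divisible-reduction true n₁ b c [] j λ r r≤b⊓c →
  ∣⁺-weight-transfer true n₁ b c r (ℕP.≤-trans r≤b⊓c (ℕP.m⊓n≤n b c)) (Ssum-divisible n₁ r [] j j≤1)
Ssum-divisible n₁ b (c ∷ l@(d ∷ _)) zero         _         = divisible-reduction false n₁ b c l 0 λ r _ →
  ∣⁺-weight false n₁ b c d r (Ssum-divisible n₁ r l 0 z≤n)
Ssum-divisible n₁ b (c ∷ l@(d ∷ _)) (suc j)      (s≤s j≤m-2) = divisible-reduction true n₁ b c l j λ r _ →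
  ∣⁺-weight true n₁ b c d r (Ssum-divisible n₁ r l j j≤m-2)

theorem1p3 : (n₁ : ℕ) (rest : List ℕ) → All (λ x → 0 < x) (n₁ ∷ rest) →
    (j : ℕ) → j ≤ length rest →
    ∃ λ (P : List ℕ) →
      map +_ P *ₚ qbin (n₁ + lastOf n₁ rest) n₁ ≈ₚ Ssum n₁ rest j
theorem1p3 zero    []         (() ∷ _) _       _
theorem1p3 (suc n) []         _        zero    _ = [] , coeff-≡ (≋-sym (Ssum-single n))
theorem1p3 (suc n) []         _        (suc j) ()
theorem1p3 n₁      (b ∷ rest) _        j       j≤m-1 with Ssum-divisible n₁ b rest j j≤m-1
... | P , P≥0 , P*D≋S = map ℤ.∣_∣ P , coeff-≡ (≋-trans (*ₚ-congʳ _ (nonneg⇒natural P P≥0)) P*D≋S)
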